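{- Let $n>2$, $w_0 = n(n-1)\cdots 21\in\mathfrak{S}_n$, and $A = \ell(w_0) = n(n-1)/2$. Among all rhombic tilings of Elnitsky polygons $X(w)$ with $\ell(w) = A$ (i.e. with $A$ tiles), those minimizing the number of (strong) perimeter tiles are not tilings of $X(w_0)$: there is a permutation $w$ with $\ell(w)=A$ and a tiling $T\in T(w)$ with $\mathsf{perim}(T) < \mathsf{perim}(T')$ for every $T' \in T(w_0)$.
   Context: Elnitsky's polygon $X(w)$ for $w\in\mathfrak{S}_m$ (with $m>1$ and $\{w(1),\ldots,w(r)\}\ne\{1,\ldots,r\}$ for $r<m$): starting at the top vertex, label the sides $1,\ldots,m,w(m),\ldots,w(1)$ counterclockwise; sides $1,\dots,m$ form half of a convex $2m$-gon; the other sides are drawn so sides are parallel and congruent iff equally labeled. $T(w)$ is the set of tilings of $X(w)$ by rhombi whose edges are congruent and parallel to edges of $X(w)$; every such tiling has $\ell(w)$ tiles, $\ell(w)$ the number of inversions of $w$. A (strong) perimeter tile shares a path of at least two of its edges with the boundary of $X(w)$; $\mathsf{perim}(T)$ counts them. -}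

module Defs where

open import Data.Nat using (ℕ; zero; suc; _<_)
open import Data.Bool using (Bool; true; false; _∧_; _∨_; if_then_else_)
open import Data.Fin as Fin using (Fin; toℕ)
open import Data.Fin.Subset using (Subset; ⁅_⁆; _∪_)
import Data.Fin.Subset as Sub
open import Data.Fin.Permutation using (Permutation′; _⟨$⟩ʳ_)
open import Data.Vec using (Vec; []; _∷_; tabulate; allFin; lookup)
open import Data.Vec.Properties using (≡-dec)
open import Data.List using (List; []; _∷_)
import Data.List as List
open import Data.Product using (_×_; _,_; proj₁; proj₂)
open import Relation.Nullary using (¬_)
open import Relation.Nullary.Decidable using (⌊_⌋)
open import Relation.Binary.PropositionalEquality using (_≡_)
import Data.Bool.Properties as BoolP
open import Data.Bool.ListAction using (any)

-- Conventions.  A permutation w ∈ 𝔖ₘ is a 'Permutation′ m'; the labels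
-- 1,…,m of the paper are 'Fin m' (0-based), w(i) is 'w ⟨$⟩ʳ i'.

word : ∀ {m} → Permutation′ m → Vec (Fin m) m
word w = tabulate (w ⟨$⟩ʳ_)

idWord : ∀ m → Vec (Fin m) m
idWord m = allFin m

len : ∀ {m} → Permutation′ m → ℕ
len {m} w =
  List.length
    (List.filter (λ p → (w ⟨$⟩ʳ proj₂ p) Fin.<? (w ⟨$⟩ʳ proj₁ p))
      (List.filter (λ p → proj₁ p Fin.<? proj₂ p)
        (List.cartesianProduct (List.allFin m) (List.allFin m))))

prefix : ∀ {m n} → Vec (Fin m) n → ℕ → Subset m
prefix []      _       = Sub.⊥
prefix (x ∷ u) zero    = Sub.⊥
prefix (x ∷ u) (suc k) = ⁅ x ⁆ ∪ prefix u k

-- Elnitsky's standing hypothesis: m > 1 and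
-- {w(1),…,w(r)} ≠ {1,…,r} for all 0 < r < m.
ElnitskyAdmissible : ∀ {m} → Permutation′ m → Set
ElnitskyAdmissible {m} w =
  (1 < m) × ((r : ℕ) → 0 < r → r < m → ¬ (prefix (word w) r ≡ prefix (idWord m) r))

-- Every vertex of a rhombic tiling of X(w) is identified with the set
-- S ⊆ {1..m} of edge labels on any monotone path from the top vertex to
-- it.  A rhombus with edge directions a < b and top vertex S has the
-- vertices S, S∪{a}, S∪{b}, S∪{a,b}.

record Tile (m : ℕ) : Set where
  constructor tile
  field
    top : Subset m
    a   : Fin m
    b   : Fin m

-- An edge is given by its upper endpoint S and its label c
-- (it joins S and S ∪ {c}).
Edge : ℕ → Set
Edge m = Subset m × Fin m

-- A monotone top-to-bottom path through the tiling is a word (the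
-- sequence of its edge labels).  Flip u v S a b: the path v is obtained
-- from u by pushing it across the rhombus with top vertex S and labels
-- a < b (u reads …ab… at vertex S, v reads …ba…).
data Flip {m : ℕ} : ∀ {n} → Vec (Fin m) n → Vec (Fin m) n → Subset m → Fin m → Fin m → Set where
  here  : ∀ {n} {a b : Fin m} {u : Vec (Fin m) n} → a Fin.< b →
          Flip (a ∷ b ∷ u) (b ∷ a ∷ u) Sub.⊥ a b
  there : ∀ {n} {x a b : Fin m} {S : Subset m} {u v : Vec (Fin m) n} →
          Flip u v S a b → Flip (x ∷ u) (x ∷ v) (⁅ x ⁆ ∪ S) a b

-- Sweep t u T: the rhombi T, removed one at a time, sweep the path u
-- (left to right) onto the path t.
data Sweep {m : ℕ} (t : Vec (Fin m) m) : Vec (Fin m) m → List (Tile m) → Set where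
  done : Sweep t t []
  step : ∀ {u v S a b T} → Flip u v S a b → Sweep t v T → Sweep t u (tile S a b ∷ T)

-- T ∈ T(w): T is (the list of tiles of) a rhombic tiling of X(w), whose
-- left boundary reads 1 2 … m and right boundary reads w(1) … w(m).
IsTiling : ∀ {m} → Permutation′ m → List (Tile m) → Set
IsTiling {m} w T = Sweep (word w) (idWord m) T

_≟S_ : ∀ {m} → (S S' : Subset m) → Bool
S ≟S S' = ⌊ ≡-dec BoolP._≟_ S S' ⌋

boundaryEdge : ∀ {m} → Permutation′ m → Edge m → Bool
boundaryEdge {m} w (S , c) =
  any (λ k → onPath (idWord m) k ∨ onPath (word w) k) (List.allFin m)
  where
    onPath : Vec (Fin m) m → Fin m → Bool
    onPath u k = (S ≟S prefix u (toℕ k)) ∧ ⌊ c Fin.≟ lookup u k ⌋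

-- The four edges of the rhombus in cyclic order:
--   S → S∪{a} → S∪{a,b} → S∪{b} → S .
-- A (strong) perimeter tile has two consecutive edges on the boundary.
isPerimeter : ∀ {m} → Permutation′ m → Tile m → Bool
isPerimeter w (tile S a b) =
    (e₁ ∧ e₂) ∨ (e₂ ∧ e₃) ∨ (e₃ ∧ e₄) ∨ (e₄ ∧ e₁)
  where
    e₁ = boundaryEdge w (S , a)
    e₂ = boundaryEdge w (⁅ a ⁆ ∪ S , b)
    e₃ = boundaryEdge w (⁅ b ⁆ ∪ S , a)
    e₄ = boundaryEdge w (S , b)

perim : ∀ {m} → Permutation′ m → List (Tile m) → ℕ
perim w []      = 0
perim w (t ∷ T) = if isPerimeter w t then suc (perim w T) else perim w T

{-# OPTIONS --safe #-}
-- Take m = A + 1 and w = 2 3 … m 1, so that ℓ(w) = A. Carrying the label 1 from the top of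
-- X(w) to its bottom tiles X(w) by a single strip of A rhombi, and only the first and the last
-- of them are perimeter tiles.
--
-- Conversely, read a tiling of X(w₀) as a sequence of flips of adjacent letters sweeping the
-- left side 1 2 … n onto the right side n … 1. If the first flip at the front brings c forward,
-- some earlier flip exchanges letters i, i + 1 ≤ c while 1 … i + 1 are still in place: its
-- rhombus has two edges on the left side. Reflecting in the vertical axis gives such a rhombus
-- on the right side, and for n > 2 the two differ. A third one is the top corner if c = n, the
-- bottom corner if the same happens upside down, and otherwise a lower left or lower right
-- rhombus (again upside down), which counting positions separates from the upper ones.

module Submission where

open import Defs
open import Data.Nat using (ℕ; _<_; _*_; _∸_; _/_)
open import Data.Product using (Σ; _×_)
open import Data.List using (List)
open import Data.Fin.Permutation using (Permutation′; reverse)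
open import Relation.Binary.PropositionalEquality using (_≡_)

open import Data.Bool using (true; false; T; _∧_; _∨_)
import Data.Bool.Properties as Bool
open import Data.Bool.Properties using (T-∧; T-∨)
open import Data.Empty using (⊥; ⊥-elim)
open import Data.Fin as Fin using (Fin; toℕ; fromℕ<)
open import Data.Fin.Permutation using (_⟨$⟩ʳ_; permutation)
open import Data.Fin.Properties using (toℕ-injective; toℕ-fromℕ<; toℕ<n; toℕ-inject₁; toℕ-fromℕ; opposite-prop)
import Data.Fin.Relation.Unary.Top as Top
open import Data.Fin.Subset using (Subset; ⁅_⁆; _∪_; _∈_)
import Data.Fin.Subset as Subset
open import Data.Fin.Subset.Properties
  using (∉⊥; x∈p∪q⁻; x∈p∪q⁺; x∈⁅y⁆⇒x≡y; x∈⁅x⁆; ∪-assoc; ∪-comm; ⊆-antisym)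
open import Data.List using ([]; _∷_; map; reverseAcc; _++_; [_]; _∷ʳ_)
import Data.List as List
import Data.List.Properties as List
open import Data.List.Membership.Propositional.Properties using (∈-allFin)
open import Data.List.Relation.Binary.Pointwise using (Pointwise; []; _∷_)
open import Data.List.Relation.Unary.All using (All; []; _∷_; all?)
import Data.List.Relation.Unary.All.Properties as All
open import Data.List.Relation.Unary.Any using (Any; here; there)
import Data.List.Relation.Unary.Any as Any
import Data.List.Relation.Unary.Any.Properties as Any
open import Data.Nat using (zero; suc; _+_; _≤_; z≤n; s≤s; _≟_; _≤?_; _<?_)
open import Data.Nat.DivMod using (m≥n⇒m/n>0)
open import Data.Nat.Properties
open import Data.Product using (_,_; proj₁; proj₂; ∃)
import Data.Product as Product
open import Data.Sum using (_⊎_; inj₁; inj₂)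
import Data.Sum as Sum
open import Data.Vec using (Vec; []; _∷_; tabulate; lookup)
import Data.Vec as Vec
open import Data.Vec.Properties using (≡-dec; lookup∘tabulate; lookup-allFin)
import Data.Vec.Properties as Vec
open import Function using (_∘_; id; Equivalence)
open import Relation.Binary using (tri<; tri≈; tri>)
open import Relation.Binary.PropositionalEquality
  using (_≢_; refl; sym; trans; cong; cong₂; subst; subst₂; module ≡-Reasoning)
open import Relation.Nullary using (¬_; Dec; yes; no; ¬?)
open import Relation.Nullary.Decidable using (⌊_⌋)
open import Relation.Unary using (_⊆_; _∩_) renaming (_⊥_ to Disjoint)

swapAt : ℕ → ℕ → ℕ
swapAt p j with j ≟ p
... | yes _ = suc p
... | no _ with j ≟ suc p
...   | yes _ = p
...   | no _ = j

swapAt-here : ∀ p → swapAt p p ≡ suc p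
swapAt-here p with p ≟ p
... | yes _ = refl
... | no p≢p = ⊥-elim (p≢p refl)

swapAt-next : ∀ p → swapAt p (suc p) ≡ p
swapAt-next p with suc p ≟ p
... | yes 1+p≡p = ⊥-elim (1+n≢n 1+p≡p)
... | no _ with suc p ≟ suc p
...   | yes _ = refl
...   | no 1+p≢1+p = ⊥-elim (1+p≢1+p refl)

swapAt-other : ∀ {p j} → j ≢ p → j ≢ suc p → swapAt p j ≡ j
swapAt-other {p} {j} j≢p j≢1+p with j ≟ p
... | yes j≡p = ⊥-elim (j≢p j≡p)
... | no _ with j ≟ suc p
...   | yes j≡1+p = ⊥-elim (j≢1+p j≡1+p)
...   | no _ = refl

data SwapAtView (p : ℕ) : ℕ → Set where
  at-here  : SwapAtView p p
  at-next  : SwapAtView p (suc p)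
  at-other : ∀ {j} → j ≢ p → j ≢ suc p → SwapAtView p j

swapAtView : ∀ p j → SwapAtView p j
swapAtView p j with j ≟ p
... | yes refl = at-here
... | no j≢p with j ≟ suc p
...   | yes refl = at-next
...   | no j≢1+p = at-other j≢p j≢1+p

swapAt-involutive : ∀ p j → swapAt p (swapAt p j) ≡ j
swapAt-involutive p j with swapAtView p j
... | at-here  = trans (cong (swapAt p) (swapAt-here p)) (swapAt-next p)
... | at-next  = trans (cong (swapAt p) (swapAt-next p)) (swapAt-here p)
... | at-other j≢p j≢1+p =
  trans (cong (swapAt p) (swapAt-other j≢p j≢1+p)) (swapAt-other j≢p j≢1+p)

swapAt-below : ∀ {p j} → j < p → swapAt p j ≡ j
swapAt-below j<p = swapAt-other (<⇒≢ j<p) (<⇒≢ (m<n⇒m<1+n j<p))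

swapAt-zero : ∀ {p} → p ≢ 0 → swapAt p 0 ≡ 0
swapAt-zero p≢0 = swapAt-other (p≢0 ∘ sym) (λ ())

swapAt-suc : ∀ p j → swapAt (suc p) (suc j) ≡ suc (swapAt p j)
swapAt-suc p j with swapAtView p j
... | at-here  = trans (swapAt-here (suc p)) (cong suc (sym (swapAt-here p)))
... | at-next  = trans (swapAt-next (suc p)) (cong suc (sym (swapAt-next p)))
... | at-other j≢p j≢1+p =
  trans (swapAt-other (j≢p ∘ suc-injective) (j≢1+p ∘ suc-injective))
        (cong suc (sym (swapAt-other j≢p j≢1+p)))

swapAt-< : ∀ {n p} j → suc p < n → j < n → swapAt p j < n
swapAt-< {p = p} j 1+p<n j<n with swapAtView p j
... | at-here  rewrite swapAt-here p = 1+p<n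
... | at-next  rewrite swapAt-next p = <-trans (n<1+n p) 1+p<n
... | at-other j≢p j≢1+p rewrite swapAt-other j≢p j≢1+p = j<n

swapAt-monotone : ∀ p {i j} → i < j → ¬ (i ≡ p × j ≡ suc p) → swapAt p i < swapAt p j
swapAt-monotone p {i} {j} i<j not-swapped with swapAtView p i | swapAtView p j
... | at-here  | at-here  = ⊥-elim (<-irrefl refl i<j)
... | at-here  | at-next  = ⊥-elim (not-swapped (refl , refl))
... | at-here  | at-other j≢p j≢1+p
  rewrite swapAt-here p | swapAt-other j≢p j≢1+p = ≤∧≢⇒< i<j (j≢1+p ∘ sym)
... | at-next  | at-here  = ⊥-elim (<-asym i<j (n<1+n p))
... | at-next  | at-next  = ⊥-elim (<-irrefl refl i<j)
... | at-next  | at-other j≢p j≢1+p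
  rewrite swapAt-next p | swapAt-other j≢p j≢1+p = <-trans (n<1+n p) i<j
... | at-other i≢p i≢1+p | at-here
  rewrite swapAt-other i≢p i≢1+p | swapAt-here p = m<n⇒m<1+n i<j
... | at-other i≢p i≢1+p | at-next
  rewrite swapAt-other i≢p i≢1+p | swapAt-next p = ≤∧≢⇒< (≤-pred i<j) i≢p
... | at-other i≢p i≢1+p | at-other j≢p j≢1+p
  rewrite swapAt-other i≢p i≢1+p | swapAt-other j≢p j≢1+p = i<j

data AtLeast {A : Set} (Q : A → Set) : ℕ → List A → Set where
  []   : ∀ {xs} → AtLeast Q 0 xs
  skip : ∀ {k x xs} → AtLeast Q k xs → AtLeast Q k (x ∷ xs)
  take : ∀ {k x xs} → Q x → AtLeast Q k xs → AtLeast Q (suc k) (x ∷ xs)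

module _ {A : Set} {Q : A → Set} where

  any⇒atLeast1 : ∀ {P : A → Set} {xs} → P ⊆ Q → Any P xs → AtLeast Q 1 xs
  any⇒atLeast1 P⊆Q (here px) = take (P⊆Q px) []
  any⇒atLeast1 P⊆Q (there pxs) = skip (any⇒atLeast1 P⊆Q pxs)

  any⇒atLeast2 : ∀ {P₁ P₂ : A → Set} {xs} → P₁ ⊆ Q → P₂ ⊆ Q → Disjoint P₁ P₂ →
                 Any P₁ xs → Any P₂ xs → AtLeast Q 2 xs
  any⇒atLeast2 _ _ P₁⊥P₂ (here p₁) (here p₂) = ⊥-elim (P₁⊥P₂ (p₁ , p₂))
  any⇒atLeast2 P₁⊆Q P₂⊆Q _ (here p₁) (there ps₂) = take (P₁⊆Q p₁) (any⇒atLeast1 P₂⊆Q ps₂)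
  any⇒atLeast2 P₁⊆Q P₂⊆Q _ (there ps₁) (here p₂) = take (P₂⊆Q p₂) (any⇒atLeast1 P₁⊆Q ps₁)
  any⇒atLeast2 P₁⊆Q P₂⊆Q P₁⊥P₂ (there ps₁) (there ps₂) =
    skip (any⇒atLeast2 P₁⊆Q P₂⊆Q P₁⊥P₂ ps₁ ps₂)

  any⇒atLeast3 : ∀ {P₁ P₂ P₃ : A → Set} {xs} → P₁ ⊆ Q → P₂ ⊆ Q → P₃ ⊆ Q →
                 Disjoint P₁ P₂ → Disjoint P₁ P₃ → Disjoint P₂ P₃ →
                 Any P₁ xs → Any P₂ xs → Any P₃ xs → AtLeast Q 3 xs
  any⇒atLeast3 _ _ _ P₁⊥P₂ _ _ (here p₁) (here p₂) _ = ⊥-elim (P₁⊥P₂ (p₁ , p₂))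
  any⇒atLeast3 _ _ _ _ P₁⊥P₃ _ (here p₁) _ (here p₃) = ⊥-elim (P₁⊥P₃ (p₁ , p₃))
  any⇒atLeast3 _ _ _ _ _ P₂⊥P₃ _ (here p₂) (here p₃) = ⊥-elim (P₂⊥P₃ (p₂ , p₃))
  any⇒atLeast3 P₁⊆Q P₂⊆Q P₃⊆Q _ _ P₂⊥P₃ (here p₁) (there ps₂) (there ps₃) =
    take (P₁⊆Q p₁) (any⇒atLeast2 P₂⊆Q P₃⊆Q P₂⊥P₃ ps₂ ps₃)
  any⇒atLeast3 P₁⊆Q P₂⊆Q P₃⊆Q _ P₁⊥P₃ _ (there ps₁) (here p₂) (there ps₃) =
    take (P₂⊆Q p₂) (any⇒atLeast2 P₁⊆Q P₃⊆Q P₁⊥P₃ ps₁ ps₃)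
  any⇒atLeast3 P₁⊆Q P₂⊆Q P₃⊆Q P₁⊥P₂ _ _ (there ps₁) (there ps₂) (here p₃) =
    take (P₃⊆Q p₃) (any⇒atLeast2 P₁⊆Q P₂⊆Q P₁⊥P₂ ps₁ ps₂)
  any⇒atLeast3 P₁⊆Q P₂⊆Q P₃⊆Q P₁⊥P₂ P₁⊥P₃ P₂⊥P₃ (there ps₁) (there ps₂) (there ps₃) =
    skip (any⇒atLeast3 P₁⊆Q P₂⊆Q P₃⊆Q P₁⊥P₂ P₁⊥P₃ P₂⊥P₃ ps₁ ps₂ ps₃)

any-∩-all : ∀ {A : Set} {P Q : A → Set} {xs} → All P xs → Any Q xs → Any (P ∩ Q) xs
any-∩-all (px ∷ _) (here qx) = here (px , qx)
any-∩-all (_ ∷ pxs) (there qxs) = there (any-∩-all pxs qxs)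

module Words (n : ℕ) where

  -- A path is recorded as the function from positions to letters; both count from 0, so the
  -- letter i is the label i + 1 of the paper.
  Word : Set
  Word = ℕ → ℕ

  Move : Set
  Move = Word × ℕ

  position : Move → ℕ
  position = proj₂

  infix 4 _≈_
  _≈_ : Word → Word → Set
  u ≈ v = ∀ j → j < n → u j ≡ v j

  swap : ℕ → Word → Word
  swap p u = u ∘ swapAt p

  record IsPermutation (u : Word) : Set where
    field
      bounded    : ∀ j → j < n → u j < n
      injective  : ∀ i j → i < n → j < n → u i ≡ u j → i ≡ j
      surjective : ∀ x → x < n → ∃ λ j → j < n × u j ≡ x
  open IsPermutation public

  data Flips : Word → Word → List Move → Set where
    done : ∀ {s t} → s ≈ t → Flips s t []
    step : ∀ {u u′ t p R} → suc p < n → u p < u (suc p) → u′ ≈ swap p u →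
           Flips u′ t R → Flips u t ((u , p) ∷ R)

  Precedes : ℕ → ℕ → Word → Set
  Precedes x y u = ∃ λ i → ∃ λ j → i < j × j < n × u i ≡ x × u j ≡ y

  isPermutation-resp-≈ : ∀ {u v} → IsPermutation u → v ≈ u → IsPermutation v
  isPermutation-resp-≈ {u} {v} P v≈u = record
    { bounded    = λ j j<n → subst (_< n) (sym (v≈u j j<n)) (bounded P j j<n)
    ; injective  = λ i j i<n j<n vi≡vj →
        injective P i j i<n j<n (trans (sym (v≈u i i<n)) (trans vi≡vj (v≈u j j<n)))
    ; surjective = λ x x<n → let (j , j<n , uj≡x) = surjective P x x<n in
        j , j<n , trans (v≈u j j<n) uj≡x
    }

  isPermutation-id : IsPermutation id
  isPermutation-id = record
    { bounded = λ _ j<n → j<n ; injective = λ _ _ _ _ i≡j → i≡j ; surjective = λ x x<n → x , x<n , refl }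

  isPermutation-swap : ∀ {u} p → suc p < n → IsPermutation u → IsPermutation (swap p u)
  isPermutation-swap {u} p 1+p<n P = record
    { bounded    = λ j j<n → bounded P (swapAt p j) (swapAt-< j 1+p<n j<n)
    ; injective  = λ i j i<n j<n ui≡uj →
        trans (sym (swapAt-involutive p i))
          (trans (cong (swapAt p) (injective P _ _ (swapAt-< i 1+p<n i<n) (swapAt-< j 1+p<n j<n) ui≡uj))
                 (swapAt-involutive p j))
    ; surjective = λ x x<n → let (j , j<n , uj≡x) = surjective P x x<n in
        swapAt p j , swapAt-< j 1+p<n j<n , trans (cong u (swapAt-involutive p j)) uj≡x
    }

  isPermutation-step : ∀ {u u′ p} → suc p < n → u′ ≈ swap p u → IsPermutation u → IsPermutation u′
  isPermutation-step {p = p} 1+p<n u′≈ P = isPermutation-resp-≈ (isPermutation-swap p 1+p<n P) u′≈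

  precedes-resp-≈ : ∀ {x y u v} → Precedes x y u → v ≈ u → Precedes x y v
  precedes-resp-≈ (i , j , i<j , j<n , ui≡x , uj≡y) v≈u =
    i , j , i<j , j<n , trans (v≈u i (<-trans i<j j<n)) ui≡x , trans (v≈u j j<n) uj≡y

  -- Flips only ever swap an ascent, so an inversion is never undone.
  precedes-swap : ∀ {x y u} p → suc p < n → u p < u (suc p) → y < x →
                  Precedes x y u → Precedes x y (swap p u)
  precedes-swap {x} {y} {u} p 1+p<n ascent y<x (i , j , i<j , j<n , ui≡x , uj≡y) =
    swapAt p i , swapAt p j , swapAt-monotone p i<j not-swapped , swapAt-< j 1+p<n j<n ,
    trans (cong u (swapAt-involutive p i)) ui≡x , trans (cong u (swapAt-involutive p j)) uj≡y
    where
    not-swapped : ¬ (i ≡ p × j ≡ suc p)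
    not-swapped (refl , refl) = <-asym y<x (subst₂ _<_ ui≡x uj≡y ascent)

  precedes-step : ∀ {x y u u′} p → suc p < n → u p < u (suc p) → u′ ≈ swap p u → y < x →
                  Precedes x y u → Precedes x y u′
  precedes-step p 1+p<n ascent u′≈ y<x x≺y = precedes-resp-≈ (precedes-swap p 1+p<n ascent y<x x≺y) u′≈

  data FirstFrontFlip (c : ℕ) : List Move → Set where
    here  : ∀ {u R} → u 1 ≡ c → FirstFrontFlip c ((u , 0) ∷ R)
    there : ∀ {u p R} → p ≢ 0 → FirstFrontFlip c R → FirstFrontFlip c ((u , p) ∷ R)

  AwayFromFront : List Move → Set
  AwayFromFront = All (λ s → position s ≢ 0)

  data LastFrontFlip (c : ℕ) : List Move → Set where
    here  : ∀ {u R} → u 0 ≡ c → AwayFromFront R → LastFrontFlip c ((u , 0) ∷ R)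
    there : ∀ {s R} → LastFrontFlip c R → LastFrontFlip c (s ∷ R)

  1+p<n⇒0<n : ∀ {p} → suc p < n → 0 < n
  1+p<n⇒0<n = ≤-<-trans z≤n

  1+p<n⇒p<n : ∀ {p} → suc p < n → p < n
  1+p<n⇒p<n = <-trans (n<1+n _)

  step-keeps-front : ∀ {u u′ p} → suc p < n → u′ ≈ swap p u → p ≢ 0 → u′ 0 ≡ u 0
  step-keeps-front {u} 1+p<n u′≈ p≢0 = trans (u′≈ 0 (1+p<n⇒0<n 1+p<n)) (cong u (swapAt-zero p≢0))

  front-preserved : ∀ {u t R} → 0 < n → Flips u t R → AwayFromFront R → u 0 ≡ t 0
  front-preserved 0<n (done u≈t) [] = u≈t 0 0<n
  front-preserved {u} 0<n (step 1+p<n _ u′≈ flips) (p≢0 ∷ away) =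
    trans (sym (step-keeps-front {u} 1+p<n u′≈ p≢0)) (front-preserved 0<n flips away)

  -- While 0 stays in front, a letter preceded by a larger one cannot reach position 1
  -- without that larger letter sitting at position 0.
  firstFront-¬inverted : ∀ {u t R x c} → Flips u t R → IsPermutation u → u 0 ≡ 0 →
                         Precedes x c u → c < x → ¬ FirstFrontFlip c R
  firstFront-¬inverted (step 1+p<n _ _ _) P u0≡0 (i , j , i<j , j<n , ui≡x , uj≡c) c<x (here u1≡c)
    with injective P j 1 j<n 1+p<n (trans uj≡c (sym u1≡c)) | i<j
  ... | refl | s≤s z≤n = <⇒≢ (≤-<-trans z≤n c<x) (trans (sym u0≡0) ui≡x)
  firstFront-¬inverted {u} (step {p = p} 1+p<n ascent u′≈ flips) P u0≡0 x≺c c<x (there p≢0 first) =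
    firstFront-¬inverted flips (isPermutation-step 1+p<n u′≈ P)
      (trans (step-keeps-front {u} 1+p<n u′≈ p≢0) u0≡0) (precedes-step p 1+p<n ascent u′≈ c<x x≺c) c<x first

  -- The rhombus crossed has its two upper edges on the left side 1 2 … n of X(w₀): the first
  -- p letters of u are 0 … p - 1 in some order, followed by p and p + 1.
  LeftMove : Move → Set
  LeftMove (u , p) = suc p < n × u p ≡ p × u (suc p) ≡ suc p ×
                     (∀ j → j < n → u j < p → j < p) × (∀ j → j < p → u j < p)

  FixesUpTo : ℕ → Word → Set
  FixesUpTo c u = ∀ j → j ≤ c → j < n → u j ≡ j

  leftMove-fixesUpTo : ∀ {u p} → suc p < n → IsPermutation u → FixesUpTo (suc p) u → LeftMove (u , p)
  leftMove-fixesUpTo {u} {p} 1+p<n P fixes =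
    1+p<n , fixes p (n≤1+n p) p<n , fixes (suc p) ≤-refl 1+p<n , reflects , preserves
    where
    p<n = 1+p<n⇒p<n 1+p<n
    reflects : ∀ j → j < n → u j < p → j < p
    reflects j j<n uj<p =
      subst (_< p) (injective P (u j) j uj<n j<n (fixes (u j) (≤-trans (<⇒≤ uj<p) (n≤1+n p)) uj<n)) uj<p
      where uj<n = <-trans uj<p p<n
    preserves : ∀ j → j < p → u j < p
    preserves j j<p = subst (_< p) (sym (fixes j (≤-trans (<⇒≤ j<p) (n≤1+n p)) (<-trans j<p p<n))) j<p

  -- Consider the first flip at a position ≤ c. Below c it is a left move; at c itself it would
  -- put c + 1 ahead of c for good, which firstFront-¬inverted rules out.
  leftMove-before-firstFront : ∀ {u t R} c → Flips u t R → IsPermutation u → FixesUpTo c u →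
                               FirstFrontFlip c R → Any (λ s → LeftMove s × position s < c) R
  leftMove-before-firstFront {u} c (step {p = p} {R = R} 1+p<n ascent u′≈ flips) P fixes first
    with <-cmp p c
  ... | tri< p<c _ _ = here (leftMove-fixesUpTo 1+p<n P (λ j j≤1+p → fixes j (≤-trans j≤1+p p<c)) , p<c)
  ... | tri≈ _ refl _ = ⊥-elim (flip-at-c first)
    where
    p<n = 1+p<n⇒p<n 1+p<n
    flip-at-c : ¬ FirstFrontFlip p ((u , p) ∷ R)
    flip-at-c (here u1≡0) with injective P 1 0 1+p<n p<n (trans u1≡0 (sym (fixes 0 z≤n p<n)))
    ... | ()
    flip-at-c (there p≢0 first′) =
      firstFront-¬inverted flips (isPermutation-step 1+p<n u′≈ P)
        (trans (step-keeps-front {u} 1+p<n u′≈ p≢0) (fixes 0 z≤n (1+p<n⇒0<n 1+p<n)))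
        (precedes-resp-≈ (p , suc p , n<1+n p , 1+p<n , cong u (swapAt-here p) ,
                          trans (cong u (swapAt-next p)) (fixes p ≤-refl p<n)) u′≈)
        (subst (_< u (suc p)) (fixes p ≤-refl p<n) ascent) first′
  ... | tri> _ _ c<p = there (leftMove-before-firstFront c flips (isPermutation-step 1+p<n u′≈ P) fixes′ (later first))
    where
    p≢0 : p ≢ 0
    p≢0 p≡0 = <⇒≱ c<p (subst (_≤ c) (sym p≡0) z≤n)
    later : FirstFrontFlip c ((u , p) ∷ R) → FirstFrontFlip c R
    later (here _) = ⊥-elim (p≢0 refl)
    later (there _ first′) = first′
    fixes′ : FixesUpTo c _
    fixes′ j j≤c j<n = trans (u′≈ j j<n) (trans (cong u (swapAt-below (≤-<-trans j≤c c<p))) (fixes j j≤c j<n))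

  lastFrontFlip-≥ : ∀ {u t R c c′} → Flips u t R → IsPermutation u → (∀ x → x < c → Precedes c x u) →
                    LastFrontFlip c′ R → c ≤ c′
  lastFrontFlip-≥ {c = c} {c′} (step 1+p<n _ _ _) P c≺smaller (here u0≡c′ _) with c ≤? c′
  ... | yes c≤c′ = c≤c′
  ... | no c≰c′ with c≺smaller c′ (≰⇒> c≰c′)
  ...   | (i , j , i<j , j<n , _ , uj≡c′) with injective P j 0 j<n (1+p<n⇒0<n 1+p<n) (trans uj≡c′ (sym u0≡c′)) | i<j
  ...     | refl | ()
  lastFrontFlip-≥ (step {p = p} 1+p<n ascent u′≈ flips) P c≺smaller (there last) =
    lastFrontFlip-≥ flips (isPermutation-step 1+p<n u′≈ P)
      (λ x x<c → precedes-step p 1+p<n ascent u′≈ x<c (c≺smaller x x<c)) last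

  -- Once the first front flip has put c in front, c precedes every smaller letter for good.
  firstFront-final⊎≤lastFront : ∀ {u t R c c′} → Flips u t R → IsPermutation u → u 0 ≡ 0 → t 0 ≡ n ∸ 1 →
                                FirstFrontFlip c R → LastFrontFlip c′ R → c ≡ n ∸ 1 ⊎ c ≤ c′
  firstFront-final⊎≤lastFront (step _ _ _ _) _ _ _ (there p≢0 _) (here _ _) = ⊥-elim (p≢0 refl)
  firstFront-final⊎≤lastFront {u} (step {p = p} 1+p<n _ u′≈ flips) P u0≡0 t0≡n-1 (there p≢0 first) (there last) =
    firstFront-final⊎≤lastFront flips (isPermutation-step 1+p<n u′≈ P)
      (trans (step-keeps-front {u} 1+p<n u′≈ p≢0) u0≡0) t0≡n-1 first last
  firstFront-final⊎≤lastFront {u} {t} {c = c} (step {u′ = u′} 1+p<n _ u′≈ flips) _ _ t0≡n-1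
                              (here u1≡c) (here _ away) =
    inj₁ (begin
      c           ≡⟨ sym u1≡c ⟩
      u 1         ≡⟨ cong u (sym (swapAt-here 0)) ⟩
      swap 0 u 0  ≡⟨ sym (u′≈ 0 (1+p<n⇒0<n 1+p<n)) ⟩
      u′ 0        ≡⟨ front-preserved (1+p<n⇒0<n 1+p<n) flips away ⟩
      t 0         ≡⟨ t0≡n-1 ⟩
      n ∸ 1       ∎)
    where open ≡-Reasoning
  firstFront-final⊎≤lastFront {u} {c = c} (step {u′ = u′} 1+p<n _ u′≈ flips) P _ _ (here u1≡c) (there last) =
    inj₂ (lastFrontFlip-≥ flips P′ c≺smaller last)
    where
    P′ = isPermutation-step 1+p<n u′≈ P
    u′0≡c : u′ 0 ≡ c
    u′0≡c = trans (u′≈ 0 (1+p<n⇒0<n 1+p<n)) (trans (cong u (swapAt-here 0)) u1≡c)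
    c≺smaller : ∀ x → x < c → Precedes c x u′
    c≺smaller x x<c with surjective P′ x (<-trans x<c (subst (_< n) u1≡c (bounded P 1 1+p<n)))
    ... | (zero , _ , u′0≡x) = ⊥-elim (<-irrefl (trans (sym u′0≡x) u′0≡c) x<c)
    ... | (suc j , j<n , u′j≡x) = 0 , suc j , s≤s z≤n , j<n , u′0≡c , u′j≡x

  firstFrontFlip-exists : ∀ R → ¬ AwayFromFront R → ∃ λ c → FirstFrontFlip c R
  firstFrontFlip-exists [] ¬away = ⊥-elim (¬away [])
  firstFrontFlip-exists ((u , zero) ∷ R) ¬away = u 1 , here refl
  firstFrontFlip-exists ((u , suc p) ∷ R) ¬away =
    let (c , first) = firstFrontFlip-exists R (¬away ∘ ((λ ()) ∷_)) in c , there (λ ()) first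

  lastFrontFlip-exists : ∀ R → ¬ AwayFromFront R → ∃ λ c → LastFrontFlip c R
  lastFrontFlip-exists [] ¬away = ⊥-elim (¬away [])
  lastFrontFlip-exists ((u , p) ∷ R) ¬away with all? (λ s → ¬? (position s ≟ 0)) R
  ... | no ¬away′ = let (c , last) = lastFrontFlip-exists R ¬away′ in c , there last
  lastFrontFlip-exists ((u , zero) ∷ R) ¬away | yes away = u 0 , here refl away
  lastFrontFlip-exists ((u , suc p) ∷ R) ¬away | yes away = ⊥-elim (¬away ((λ ()) ∷ away))

  firstFrontFlip-move : ∀ {u t R c} → Flips u t R → u 0 ≡ 0 → FirstFrontFlip c R →
                        Any (λ s → position s ≡ 0 × proj₁ s 0 ≡ 0 × proj₁ s 1 ≡ c) R
  firstFrontFlip-move (step _ _ _ _) u0≡0 (here u1≡c) = here (refl , u0≡0 , u1≡c)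
  firstFrontFlip-move {u} (step 1+p<n _ u′≈ flips) u0≡0 (there p≢0 first) =
    there (firstFrontFlip-move flips (trans (step-keeps-front {u} 1+p<n u′≈ p≢0) u0≡0) first)

  opposite : ℕ → ℕ
  opposite x = n ∸ suc x

  opposite-spec : ∀ {x} → x < n → suc x + opposite x ≡ n
  opposite-spec = m+[n∸m]≡n

  opposite-< : ∀ {x} → x < n → opposite x < n
  opposite-< {x} x<n = subst (opposite x <_) (opposite-spec x<n) (s≤s (m≤n+m (opposite x) x))

  opposite-unique : ∀ {x y} → x < n → suc x + y ≡ n → opposite x ≡ y
  opposite-unique {x} x<n eq = +-cancelˡ-≡ (suc x) _ _ (trans (opposite-spec x<n) (sym eq))

  opposite-involutive : ∀ {x} → x < n → opposite (opposite x) ≡ x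
  opposite-involutive {x} x<n =
    opposite-unique (opposite-< x<n) (trans (cong suc (+-comm (opposite x) x)) (opposite-spec x<n))

  opposite-injective : ∀ {x y} → x < n → y < n → opposite x ≡ opposite y → x ≡ y
  opposite-injective x<n y<n eq =
    trans (sym (opposite-involutive x<n)) (trans (cong opposite eq) (opposite-involutive y<n))

  opposite-reverses-< : ∀ {x y} → y < n → x < y → opposite y < opposite x
  opposite-reverses-< y<n x<y = ∸-monoʳ-< (s≤s x<y) y<n

  opposite-reflects-< : ∀ {x y} → opposite y < opposite x → x < y
  opposite-reflects-< lt = ≤-pred (∸-cancelʳ-< {o = n} lt)

  opposite-suc : ∀ {p} → suc p < n → suc (opposite (suc p)) ≡ opposite p
  opposite-suc {p} 1+p<n =
    sym (opposite-unique (1+p<n⇒p<n 1+p<n) (trans (cong suc (+-suc p _)) (opposite-spec 1+p<n)))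

  opposite-suc-opposite : ∀ {p} → suc p < n → opposite (suc (opposite (suc p))) ≡ p
  opposite-suc-opposite 1+p<n = trans (cong opposite (opposite-suc 1+p<n)) (opposite-involutive (1+p<n⇒p<n 1+p<n))

  isPermutation-opposite : ∀ {u} → IsPermutation u → IsPermutation (opposite ∘ u)
  isPermutation-opposite {u} P = record
    { bounded    = λ j j<n → opposite-< (bounded P j j<n)
    ; injective  = λ i j i<n j<n eq → injective P i j i<n j<n (opposite-injective (bounded P i i<n) (bounded P j j<n) eq)
    ; surjective = λ x x<n → let (j , j<n , uj≡x′) = surjective P (opposite x) (opposite-< x<n) in
        j , j<n , trans (cong opposite uj≡x′) (opposite-involutive x<n)
    }

  ValidMove : Move → Set
  ValidMove (u , p) = suc p < n × IsPermutation u

  validMoves : ∀ {s t R} → Flips s t R → IsPermutation s → All ValidMove R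
  validMoves (done _) P = []
  validMoves (step 1+p<n _ u′≈ flips) P = (1+p<n , P) ∷ validMoves flips (isPermutation-step 1+p<n u′≈ P)

  -- Reflection of X(w₀) in its vertical axis: labels become opposite and the sweep runs backwards.
  swapSides : Move → Move
  swapSides (u , p) = opposite ∘ swap p u , p

  swapSidesFlips-acc : ∀ {s₀ s t R A X} → Flips s t R → IsPermutation s → X ≈ opposite ∘ s →
                       Flips X (opposite ∘ s₀) A →
                       ∃ λ Y → Y ≈ opposite ∘ t × Flips Y (opposite ∘ s₀) (reverseAcc A (map swapSides R))
  swapSidesFlips-acc {X = X} (done s≈t) P X≈ acc = X , (λ j j<n → trans (X≈ j j<n) (cong opposite (s≈t j j<n))) , acc
  swapSidesFlips-acc {s = s} {X = X} (step {u′ = u′} {p = p} 1+p<n ascent u′≈ flips) P X≈ acc =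
    swapSidesFlips-acc flips (isPermutation-step 1+p<n u′≈ P) X′≈ (step 1+p<n ascent′ X≈swap acc)
    where
    X′ = opposite ∘ swap p s
    X′≈ : X′ ≈ opposite ∘ u′
    X′≈ j j<n = cong opposite (sym (u′≈ j j<n))
    ascent′ : X′ p < X′ (suc p)
    ascent′ rewrite swapAt-here p | swapAt-next p = opposite-reverses-< (bounded P (suc p) 1+p<n) ascent
    X≈swap : X ≈ swap p X′
    X≈swap j j<n = trans (X≈ j j<n) (cong (opposite ∘ s) (sym (swapAt-involutive p j)))

  swapSidesFlips : ∀ {s t R} → Flips s t R → IsPermutation s →
                   ∃ λ Y → Y ≈ opposite ∘ t × Flips Y (opposite ∘ s) (List.reverse (map swapSides R))
  swapSidesFlips flips P = swapSidesFlips-acc flips P (λ _ _ → refl) (done (λ _ _ → refl))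

  any-swapSides⁻ : ∀ {Q : Move → Set} R → Any Q (List.reverse (map swapSides R)) → Any (Q ∘ swapSides) R
  any-swapSides⁻ R = Any.map⁻ ∘ Any.reverse⁻

  firstFront-swapSides-acc : ∀ {c} R B → AwayFromFront R → FirstFrontFlip c B →
                             FirstFrontFlip c (reverseAcc B (map swapSides R))
  firstFront-swapSides-acc [] B [] first = first
  firstFront-swapSides-acc ((u , p) ∷ R) B (p≢0 ∷ away) first = firstFront-swapSides-acc R _ away (there p≢0 first)

  lastFront-swapSides-acc : ∀ {c} R A → LastFrontFlip c R → FirstFrontFlip (opposite c) (reverseAcc A (map swapSides R))
  lastFront-swapSides-acc ((u , 0) ∷ R) A (here u0≡c away) =
    firstFront-swapSides-acc R _ away (here (cong opposite (trans (cong u (swapAt-next 0)) u0≡c)))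
  lastFront-swapSides-acc (s ∷ R) A (there last) = lastFront-swapSides-acc R _ last

  lastFront-swapSides : ∀ {c} R → LastFrontFlip c R → FirstFrontFlip (opposite c) (List.reverse (map swapSides R))
  lastFront-swapSides R = lastFront-swapSides-acc R []

  -- Reflection of X(w₀) in its horizontal axis: paths are read backwards with opposite labels.
  upsideDown : Word → Word
  upsideDown u = opposite ∘ u ∘ opposite

  upsideDownMove : Move → Move
  upsideDownMove (u , p) = upsideDown u , opposite (suc p)

  isPermutation-upsideDown : ∀ {u} → IsPermutation u → IsPermutation (upsideDown u)
  isPermutation-upsideDown {u} P = record
    { bounded    = λ j j<n → opposite-< (bounded P (opposite j) (opposite-< j<n))
    ; injective  = λ i j i<n j<n eq → opposite-injective i<n j<n
        (injective P (opposite i) (opposite j) (opposite-< i<n) (opposite-< j<n)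
          (opposite-injective (bounded P _ (opposite-< i<n)) (bounded P _ (opposite-< j<n)) eq))
    ; surjective = λ x x<n → let (j , j<n , uj≡x′) = surjective P (opposite x) (opposite-< x<n) in
        opposite j , opposite-< j<n ,
        trans (cong (opposite ∘ u) (opposite-involutive j<n)) (trans (cong opposite uj≡x′) (opposite-involutive x<n))
    }

  swapAt-opposite : ∀ {p j} → suc p < n → j < n → swapAt p (opposite j) ≡ opposite (swapAt (opposite (suc p)) j)
  swapAt-opposite {p} {j} 1+p<n j<n with swapAtView (opposite (suc p)) j
  ... | at-here rewrite swapAt-here (opposite (suc p)) | opposite-involutive 1+p<n | opposite-suc-opposite 1+p<n =
    swapAt-next p
  ... | at-next rewrite swapAt-next (opposite (suc p)) | opposite-involutive 1+p<n | opposite-suc-opposite 1+p<n =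
    swapAt-here p
  ... | at-other j≢q j≢1+q rewrite swapAt-other j≢q j≢1+q = swapAt-other j′≢p j′≢1+p
    where
    j′≢p : opposite j ≢ p
    j′≢p eq = j≢1+q (trans (sym (opposite-involutive j<n)) (trans (cong opposite eq) (sym (opposite-suc 1+p<n))))
    j′≢1+p : opposite j ≢ suc p
    j′≢1+p eq = j≢q (trans (sym (opposite-involutive j<n)) (cong opposite eq))

  upsideDownFlips : ∀ {s t R} → Flips s t R → IsPermutation s → Flips (upsideDown s) (upsideDown t) (map upsideDownMove R)
  upsideDownFlips (done s≈t) P = done (λ j j<n → cong opposite (s≈t (opposite j) (opposite-< j<n)))
  upsideDownFlips {s = s} (step {u′ = u′} {p = p} 1+p<n ascent u′≈ flips) P =
    step 1+q<n ascent′ next (upsideDownFlips flips (isPermutation-step 1+p<n u′≈ P))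
    where
    p<n = 1+p<n⇒p<n 1+p<n
    q = opposite (suc p)
    1+q<n : suc q < n
    1+q<n = subst (_< n) (sym (opposite-suc 1+p<n)) (opposite-< p<n)
    ascent′ : upsideDown s q < upsideDown s (suc q)
    ascent′ = subst₂ _<_ (cong (opposite ∘ s) (sym (opposite-involutive 1+p<n)))
                         (cong (opposite ∘ s) (sym (opposite-suc-opposite 1+p<n)))
                         (opposite-reverses-< (bounded P (suc p) 1+p<n) ascent)
    next : upsideDown u′ ≈ swap q (upsideDown s)
    next j j<n = cong opposite (trans (u′≈ (opposite j) (opposite-< j<n)) (cong s (swapAt-opposite 1+p<n j<n)))

  leftMove-resp-≈ : ∀ {u v p} → v ≈ u → LeftMove (u , p) → LeftMove (v , p)
  leftMove-resp-≈ {u} {v} {p} v≈u (1+p<n , up≡p , u1+p≡1+p , reflects , preserves) =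
    1+p<n , trans (v≈u p p<n) up≡p , trans (v≈u (suc p) 1+p<n) u1+p≡1+p ,
    (λ j j<n vj<p → reflects j j<n (subst (_< p) (v≈u j j<n) vj<p)) ,
    (λ j j<p → subst (_< p) (sym (v≈u j (<-trans j<p p<n))) (preserves j j<p))
    where p<n = 1+p<n⇒p<n 1+p<n

  private
    beyond : ∀ {p x} → x ≢ p → x ≢ suc p → ¬ x < p → suc p < x
    beyond {p} {x} x≢p x≢1+p x≮p with <-cmp x (suc p)
    ... | tri< x<1+p _ _ = ⊥-elim (x≢p (≤-antisym (≤-pred x<1+p) (≮⇒≥ x≮p)))
    ... | tri≈ _ x≡1+p _ = ⊥-elim (x≢1+p x≡1+p)
    ... | tri> _ _ 1+p<x = 1+p<x

  module _ {u p} (P : IsPermutation u) (up≡p : u p ≡ p) (u1+p≡1+p : u (suc p) ≡ suc p) (1+p<n : suc p < n) where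

    reflects-before : (∀ j → j < n → suc p < j → suc p < u j) → ∀ j → j < n → u j < p → j < p
    reflects-before preserves-after j j<n uj<p with j <? p
    ... | yes j<p = j<p
    ... | no j≮p = ⊥-elim (<-asym uj<p (<-trans (n<1+n p) (preserves-after j j<n (beyond j≢p j≢1+p j≮p))))
      where
      j≢p : j ≢ p
      j≢p refl = <-irrefl up≡p uj<p
      j≢1+p : j ≢ suc p
      j≢1+p refl = <-asym uj<p (subst (p <_) (sym u1+p≡1+p) (n<1+n p))

    preserves-before : (∀ j → j < n → suc p < u j → suc p < j) → ∀ j → j < p → u j < p
    preserves-before reflects-after j j<p with u j <? p
    ... | yes uj<p = uj<p
    ... | no uj≮p = ⊥-elim (<-asym j<p (<-trans (n<1+n p) (reflects-after j j<n (beyond uj≢p uj≢1+p uj≮p))))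
      where
      j<n = <-trans j<p (1+p<n⇒p<n 1+p<n)
      uj≢p : u j ≢ p
      uj≢p eq = <⇒≢ j<p (injective P j p j<n (1+p<n⇒p<n 1+p<n) (trans eq (sym up≡p)))
      uj≢1+p : u j ≢ suc p
      uj≢1+p eq = <⇒≢ (<-trans j<p (n<1+n p)) (injective P j (suc p) j<n 1+p<n (trans eq (sym u1+p≡1+p)))

  -- Upside down, the positions before p become those after p + 1, and a permutation fixing
  -- p and p + 1 maps the former onto themselves iff it does so with the latter.
  leftMove-upsideDown : ∀ {u p} → suc p < n → IsPermutation u → LeftMove (upsideDownMove (u , p)) → LeftMove (u , p)
  leftMove-upsideDown {u} {p} 1+p<n P (_ , vq≡q , v1+q≡1+q , reflects′ , preserves′) =
    1+p<n , up≡p , u1+p≡1+p ,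
    reflects-before P up≡p u1+p≡1+p 1+p<n preserves-after , preserves-before P up≡p u1+p≡1+p 1+p<n reflects-after
    where
    p<n = 1+p<n⇒p<n 1+p<n
    q = opposite (suc p)
    u1+p≡1+p : u (suc p) ≡ suc p
    u1+p≡1+p = opposite-injective (bounded P (suc p) 1+p<n) 1+p<n
      (trans (cong (opposite ∘ u) (sym (opposite-involutive 1+p<n))) vq≡q)
    up≡p : u p ≡ p
    up≡p = opposite-injective (bounded P p p<n) p<n
      (trans (cong (opposite ∘ u) (sym (opposite-suc-opposite 1+p<n))) (trans v1+q≡1+q (opposite-suc 1+p<n)))
    v-opposite : ∀ {j} → j < n → upsideDown u (opposite j) ≡ opposite (u j)
    v-opposite j<n = cong (opposite ∘ u) (opposite-involutive j<n)
    preserves-after : ∀ j → j < n → suc p < j → suc p < u j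
    preserves-after j j<n 1+p<j =
      opposite-reflects-< (subst (_< q) (v-opposite j<n) (preserves′ (opposite j) (opposite-reverses-< j<n 1+p<j)))
    reflects-after : ∀ j → j < n → suc p < u j → suc p < j
    reflects-after j j<n 1+p<uj = opposite-reflects-<
      (reflects′ (opposite j) (opposite-< j<n)
        (subst (_< q) (sym (v-opposite j<n)) (opposite-reverses-< (bounded P j j<n) 1+p<uj)))

  leftMove-swapSides-upsideDown : ∀ {s} → ValidMove s → LeftMove (swapSides (upsideDownMove s)) → LeftMove (swapSides s)
  leftMove-swapSides-upsideDown {u , p} (1+p<n , P) left =
    leftMove-upsideDown 1+p<n (isPermutation-opposite (isPermutation-swap p 1+p<n P)) (leftMove-resp-≈ commute left)
    where
    commute : upsideDown (opposite ∘ swap p u) ≈ opposite ∘ swap (opposite (suc p)) (upsideDown u)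
    commute j j<n = cong (opposite ∘ opposite ∘ u) (swapAt-opposite 1+p<n j<n)

  RightMove : Move → Set
  RightMove = LeftMove ∘ swapSides

  -- The rhombus at the top vertex of X(w₀), with edges labelled 1 and n.
  TopMove : Move → Set
  TopMove (u , p) = p ≡ 0 × u 0 ≡ 0 × u 1 ≡ n ∸ 1

  BottomMove : Move → Set
  BottomMove = TopMove ∘ upsideDownMove

  PerimeterMove : Move → Set
  PerimeterMove s = ValidMove s × (LeftMove s ⊎ RightMove s ⊎ TopMove s ⊎ BottomMove s)

  bottom⇒n≡2+p : ∀ {p} → suc p < n → opposite (suc p) ≡ 0 → suc (suc p) ≡ n
  bottom⇒n≡2+p {p} 1+p<n q≡0 =
    trans (sym (+-identityʳ (suc (suc p)))) (trans (cong (suc (suc p) +_) (sym q≡0)) (opposite-spec 1+p<n))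

  above∩below⇒n≤c+e : ∀ {p c e} → suc p < n → p < c → opposite (suc p) < e → n ≤ c + e
  above∩below⇒n≤c+e {p} 1+p<n p<c q<e =
    subst (_≤ _) (trans (+-suc (suc p) _) (opposite-spec 1+p<n)) (+-mono-≤ p<c q<e)

  above∩below⇒c+e<n : ∀ {p c e} → p < opposite c → opposite (suc p) < opposite e → c + e < n
  above∩below⇒c+e<n {p} {c} {e} p<c′ q<e′ = ≤-<-trans (+-monoʳ-≤ c e≤p) (subst (_< n) (+-comm p c) p+c<n)
    where
    e≤p : e ≤ p
    e≤p = ≤-pred (opposite-reflects-< q<e′)
    p+c<n : p + c < n
    p+c<n = ≤-trans (s≤s (+-monoʳ-≤ p (n≤1+n c))) (m≤o∸n⇒m+n≤o (suc p) 1+c≤n p<c′)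
      where 1+c≤n = <⇒≤ (m∸n≢0⇒n<m (λ c′≡0 → n≮0 (subst (p <_) c′≡0 p<c′)))

  -- The q-th edge of the path u is the q-th edge of a side of X(w₀) whose letters are ranked
  -- by r: the left side for r = id, the right side for r = opposite.
  record EdgeAlong (r : ℕ → ℕ) (u : Word) (q : ℕ) : Set where
    field
      ranked-before : ∀ j → j < q → r (u j) < q
      before-ranked : ∀ j → j < n → r (u j) < q → j < q
      rank-at       : r (u q) ≡ q

  edgeAlong-resp-≗ : ∀ {r u v q} → (∀ j → u j ≡ v j) → EdgeAlong r u q → EdgeAlong r v q
  edgeAlong-resp-≗ {r} {q = q} u≗v e = record
    { ranked-before = λ j j<q → subst (λ x → r x < q) (u≗v j) (ranked-before j j<q)
    ; before-ranked = λ j j<n rvj<q → before-ranked j j<n (subst (λ x → r x < q) (sym (u≗v j)) rvj<q)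
    ; rank-at       = trans (cong r (sym (u≗v q))) rank-at
    }
    where open EdgeAlong e

  leftMove⇒edgesAlong : ∀ {r v p} → IsPermutation (r ∘ v) → LeftMove (r ∘ v , p) →
                        EdgeAlong r v p × EdgeAlong r v (suc p)
  leftMove⇒edgesAlong {r} {v} {p} P (1+p<n , rvp≡p , rv1+p≡1+p , reflects , preserves) =
    record { ranked-before = preserves ; before-ranked = reflects ; rank-at = rvp≡p } ,
    record { ranked-before = ranked-before ; before-ranked = before-ranked ; rank-at = rv1+p≡1+p }
    where
    ranked-before : ∀ j → j < suc p → r (v j) < suc p
    ranked-before j j<1+p with m≤n⇒m<n∨m≡n (≤-pred j<1+p)
    ... | inj₁ j<p = m<n⇒m<1+n (preserves j j<p)
    ... | inj₂ refl = subst (_< suc p) (sym rvp≡p) (n<1+n p)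
    before-ranked : ∀ j → j < n → r (v j) < suc p → j < suc p
    before-ranked j j<n rvj<1+p with m≤n⇒m<n∨m≡n (≤-pred rvj<1+p)
    ... | inj₁ rvj<p = m<n⇒m<1+n (reflects j j<n rvj<p)
    ... | inj₂ rvj≡p = s≤s (≤-reflexive (injective P j p j<n (1+p<n⇒p<n 1+p<n) (trans rvj≡p (sym rvp≡p))))

  firstEdgeAlong : ∀ {r u} → r (u 0) ≡ 0 → EdgeAlong r u 0
  firstEdgeAlong ru0≡0 = record { ranked-before = λ _ () ; before-ranked = λ _ _ () ; rank-at = ru0≡0 }

  lastEdgeAlong : ∀ {r u q} → IsPermutation (r ∘ u) → suc q ≡ n → r (u q) ≡ q → EdgeAlong r u q
  lastEdgeAlong {r} {u} {q} P 1+q≡n ruq≡q = record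
    { ranked-before = λ j j<q → ≤∧≢⇒< (≤-pred (bounded′ j (<-trans j<q q<n)))
                                  (λ ruj≡q → <⇒≢ j<q (injective P j q (<-trans j<q q<n) q<n (trans ruj≡q (sym ruq≡q))))
    ; before-ranked = λ j j<n ruj<q → ≤∧≢⇒< (≤-pred (subst (j <_) (sym 1+q≡n) j<n))
                                  (λ { refl → <-irrefl ruq≡q ruj<q })
    ; rank-at = ruq≡q
    }
    where
    q<n : q < n
    q<n = subst (q <_) 1+q≡n (n<1+n q)
    bounded′ : ∀ j → j < n → r (u j) < suc q
    bounded′ j j<n = subst (r (u j) <_) (sym 1+q≡n) (bounded P j j<n)

  -- In the order of isPerimeter: a left move has two edges on the path u before the flip, a bottom
  -- move one on u and one on the path swap p u after it, a right move two on swap p u, and a top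
  -- move again one on each.
  perimeterMove⇒edgesAlong : ∀ {u p} → PerimeterMove (u , p) →
    (EdgeAlong id u p × EdgeAlong id u (suc p)) ⊎
    (EdgeAlong id u (suc p) × EdgeAlong opposite (swap p u) (suc p)) ⊎
    (EdgeAlong opposite (swap p u) (suc p) × EdgeAlong opposite (swap p u) p) ⊎
    (EdgeAlong opposite (swap p u) p × EdgeAlong id u p)
  perimeterMove⇒edgesAlong ((_ , P) , inj₁ left) = inj₁ (leftMove⇒edgesAlong P left)
  perimeterMove⇒edgesAlong {u} {p} ((1+p<n , P) , inj₂ (inj₁ right))
    with leftMove⇒edgesAlong (isPermutation-opposite (isPermutation-swap p 1+p<n P)) right
  ... | along-p , along-1+p = inj₂ (inj₂ (inj₁ (along-1+p , along-p)))
  perimeterMove⇒edgesAlong {u} ((1+p<n , _) , inj₂ (inj₂ (inj₁ (refl , u0≡0 , u1≡n-1)))) =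
    inj₂ (inj₂ (inj₂ (firstEdgeAlong opposite-u1≡0 , firstEdgeAlong u0≡0)))
    where
    opposite-u1≡0 : opposite (u (swapAt 0 0)) ≡ 0
    opposite-u1≡0 = trans (cong (opposite ∘ u) (swapAt-here 0))
                      (trans (cong opposite u1≡n-1) (opposite-involutive (1+p<n⇒0<n 1+p<n)))
  perimeterMove⇒edgesAlong {u} {p} ((1+p<n , P) , inj₂ (inj₂ (inj₂ (q≡0 , v0≡0 , v1≡n-1)))) =
    inj₂ (inj₁ (lastEdgeAlong P n≡2+p u1+p≡1+p ,
                lastEdgeAlong (isPermutation-opposite (isPermutation-swap p 1+p<n P)) n≡2+p opposite-up≡1+p))
    where
    n≡2+p = bottom⇒n≡2+p 1+p<n q≡0
    u1+p≡1+p : u (suc p) ≡ suc p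
    u1+p≡1+p = opposite-injective (bounded P (suc p) 1+p<n) 1+p<n
      (trans (cong (opposite ∘ u) (sym (opposite-unique (1+p<n⇒0<n 1+p<n) n≡2+p)))
             (trans v0≡0 (sym q≡0)))
    opposite-up≡1+p : opposite (u (swapAt p (suc p))) ≡ suc p
    opposite-up≡1+p = begin
      opposite (u (swapAt p (suc p)))  ≡⟨ cong (opposite ∘ u) (trans (swapAt-next p) (sym opposite1≡p)) ⟩
      opposite (u (opposite 1))        ≡⟨ v1≡n-1 ⟩
      n ∸ 1                            ≡⟨ cong (_∸ 1) (sym n≡2+p) ⟩
      suc p                            ∎
      where
      open ≡-Reasoning
      opposite1≡p : opposite 1 ≡ p
      opposite1≡p = opposite-unique (subst (1 <_) n≡2+p (s≤s (s≤s z≤n))) n≡2+p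

module ReverseSweeps (n : ℕ) (2<n : 2 < n) where
  open Words n

  private
    n≢2 : n ≢ 2
    n≢2 n≡2 = <-irrefl (sym n≡2) 2<n

    n∸1≢1 : n ∸ 1 ≢ 1
    n∸1≢1 n∸1≡1 = n≢2 (trans (sym (m∸n+n≡m (<-trans (s≤s z≤n) 2<n))) (cong (_+ 1) n∸1≡1))

    n∸1≢0 : n ∸ 1 ≢ 0
    n∸1≢0 n∸1≡0 = <⇒≱ 2<n (≤-trans (m∸n≡0⇒m≤n n∸1≡0) (s≤s z≤n))

    0<n : 0 < n
    0<n = <-trans (s≤s z≤n) 2<n

    left∩right⇒n≡2+p+p : ∀ {u p} → LeftMove (u , p) → RightMove (u , p) → suc (suc p) + p ≡ n
    left∩right⇒n≡2+p+p {u} {p} (1+p<n , _ , u1+p≡1+p , _) (_ , u1+p′≡p , _) =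
      trans (cong (suc (suc p) +_) (sym opposite1+p≡p)) (opposite-spec 1+p<n)
      where
      opposite1+p≡p : opposite (suc p) ≡ p
      opposite1+p≡p = trans (cong opposite (sym u1+p≡1+p)) (trans (cong (opposite ∘ u) (sym (swapAt-here p))) u1+p′≡p)

  -- Both moves force n = 2p + 2; for p > 0 the letter u 0 and its opposite would then both be
  -- below p, although they add up to n - 1.
  left-right-disjoint : ∀ {s} → ValidMove s → LeftMove s → RightMove s → ⊥
  left-right-disjoint {u , zero} _ left right = n≢2 (sym (left∩right⇒n≡2+p+p left right))
  left-right-disjoint {u , p@(suc _)} (_ , P) left@(1+p<n , _ , _ , _ , preserves) right@(_ , _ , _ , _ , preserves′) =
    <-asym n<p+p (subst (p + p <_) (left∩right⇒n≡2+p+p left right) (<-trans (n<1+n _) (n<1+n _)))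
    where
    u0<p : u 0 < p
    u0<p = preserves 0 (s≤s z≤n)
    u0′<p : opposite (u 0) < p
    u0′<p = subst (_< p) (cong (opposite ∘ u) (swapAt-zero {p} (λ ()))) (preserves′ 0 (s≤s z≤n))
    n<p+p : n < p + p
    n<p+p = subst (_< p + p) (opposite-spec (bounded P 0 (1+p<n⇒0<n 1+p<n))) (+-mono-≤-< u0<p u0′<p)

  top-left-disjoint : ∀ {s} → TopMove s → LeftMove s → ⊥
  top-left-disjoint (refl , _ , u1≡n-1) (_ , _ , u1≡1 , _) = n∸1≢1 (trans (sym u1≡n-1) u1≡1)

  top-right-disjoint : ∀ {s} → TopMove s → RightMove s → ⊥
  top-right-disjoint {u , _} (refl , u0≡0 , _) (_ , _ , u0′≡1 , _) =
    n∸1≢1 (trans (cong opposite (sym u0≡0)) (trans (cong (opposite ∘ u) (sym (swapAt-next 0))) u0′≡1))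

  bottom-left-disjoint : ∀ {s} → ValidMove s → BottomMove s → LeftMove s → ⊥
  bottom-left-disjoint {u , p} (1+p<n , _) (q≡0 , _ , v1≡n-1) (_ , up≡p , _) = n∸1≢1 (trans (sym v1≡n-1) v1≡1)
    where
    n≡2+p = bottom⇒n≡2+p 1+p<n q≡0
    opposite1≡p : opposite 1 ≡ p
    opposite1≡p = opposite-unique (subst (1 <_) n≡2+p (s≤s (s≤s z≤n))) n≡2+p
    v1≡1 : upsideDown u 1 ≡ 1
    v1≡1 = begin
      opposite (u (opposite 1))  ≡⟨ cong (opposite ∘ u) opposite1≡p ⟩
      opposite (u p)             ≡⟨ cong opposite up≡p ⟩
      opposite p                 ≡⟨ sym (opposite-suc 1+p<n) ⟩
      suc (opposite (suc p))     ≡⟨ cong suc q≡0 ⟩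
      1                          ∎
      where open ≡-Reasoning

  bottom-right-disjoint : ∀ {s} → ValidMove s → BottomMove s → RightMove s → ⊥
  bottom-right-disjoint {u , p} (1+p<n , _) (q≡0 , v0≡0 , _) (_ , u1+p′≡p , _) =
    n≢2 (trans (sym n≡2+p) (cong (λ k → suc (suc k)) p≡0))
    where
    n≡2+p = bottom⇒n≡2+p 1+p<n q≡0
    opposite0≡1+p : opposite 0 ≡ suc p
    opposite0≡1+p = opposite-unique 0<n n≡2+p
    p≡0 : p ≡ 0
    p≡0 = begin
      p                                ≡⟨ sym u1+p′≡p ⟩
      opposite (u (swapAt p p))        ≡⟨ cong (opposite ∘ u) (trans (swapAt-here p) (sym opposite0≡1+p)) ⟩
      opposite (u (opposite 0))        ≡⟨ v0≡0 ⟩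
      0                                ∎
      where open ≡-Reasoning

  module UpperCorners {s t R} (flips : Flips s t R) (P : IsPermutation s)
                      (s≈id : s ≈ id) (t≈opposite : t ≈ opposite) where

    private
      s0≡0 : s 0 ≡ 0
      s0≡0 = s≈id 0 0<n

      flipsAtFront : ¬ AwayFromFront R
      flipsAtFront away = n∸1≢0 (trans (sym (t≈opposite 0 0<n)) (trans (sym (front-preserved 0<n flips away)) s0≡0))

      firstFront : ∃ λ c → FirstFrontFlip c R
      firstFront = firstFrontFlip-exists R flipsAtFront

      lastFront : ∃ λ c → LastFrontFlip c R
      lastFront = lastFrontFlip-exists R flipsAtFront

    c₁ : ℕ
    c₁ = proj₁ firstFront

    c′ : ℕ
    c′ = proj₁ lastFront

    c₁≡n-1⊎c₁≤c′ : c₁ ≡ n ∸ 1 ⊎ c₁ ≤ c′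
    c₁≡n-1⊎c₁≤c′ =
      firstFront-final⊎≤lastFront flips P s0≡0 (t≈opposite 0 0<n) (proj₂ firstFront) (proj₂ lastFront)

    upperLeft : Any (λ m → LeftMove m × position m < c₁) R
    upperLeft = leftMove-before-firstFront c₁ flips P (λ j _ → s≈id j) (proj₂ firstFront)

    upperRight : Any (λ m → RightMove m × position m < opposite c′) R
    upperRight with swapSidesFlips flips P
    ... | Y , Y≈ , mirrored = any-swapSides⁻ R
      (leftMove-before-firstFront (opposite c′) mirrored PY fixesY (lastFront-swapSides R (proj₂ lastFront)))
      where
      Pt : IsPermutation t
      Pt = isPermutation-resp-≈ (isPermutation-opposite isPermutation-id) t≈opposite
      PY : IsPermutation Y
      PY = isPermutation-resp-≈ (isPermutation-opposite Pt) Y≈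
      fixesY : FixesUpTo (opposite c′) Y
      fixesY j _ j<n = trans (Y≈ j j<n) (trans (cong opposite (t≈opposite j j<n)) (opposite-involutive j<n))

    top : c₁ ≡ n ∸ 1 → Any TopMove R
    top c₁≡n-1 = Any.map (λ (p≡0 , u0≡0 , u1≡c₁) → p≡0 , u0≡0 , trans u1≡c₁ c₁≡n-1)
                   (firstFrontFlip-move flips s0≡0 (proj₂ firstFront))

  module ThreePerimeterMoves {s t R} (flips : Flips s t R) (P : IsPermutation s)
                             (s≈id : s ≈ id) (t≈opposite : t ≈ opposite) where

    private
      s↕≈id : upsideDown s ≈ id
      s↕≈id j j<n = trans (cong opposite (s≈id (opposite j) (opposite-< j<n))) (opposite-involutive j<n)

      t↕≈opposite : upsideDown t ≈ opposite
      t↕≈opposite j j<n = cong opposite (trans (t≈opposite (opposite j) (opposite-< j<n)) (opposite-involutive j<n))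

      -- ↓ is the same sweep upside down; below, e and f name its first and last front letters.
      module ↑ = UpperCorners flips P s≈id t≈opposite
      module ↓ = UpperCorners (upsideDownFlips flips P) (isPermutation-upsideDown P) s↕≈id t↕≈opposite

      valid : All ValidMove R
      valid = validMoves flips P

      NearFirst NearLast FarFirst FarLast : Move → Set
      NearFirst m = position m < ↑.c₁
      NearLast m  = position m < opposite ↑.c′
      FarFirst m  = opposite (suc (position m)) < ↓.c₁
      FarLast m   = opposite (suc (position m)) < opposite ↓.c′

      UpperLeft UpperRight LowerLeft LowerRight : Move → Set
      UpperLeft  = ValidMove ∩ LeftMove ∩ NearFirst
      UpperRight = ValidMove ∩ RightMove ∩ NearLast
      LowerLeft  = ValidMove ∩ LeftMove ∩ FarFirst
      LowerRight = ValidMove ∩ RightMove ∩ FarLast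

      upperLeft : Any UpperLeft R
      upperLeft = any-∩-all valid ↑.upperLeft

      upperRight : Any UpperRight R
      upperRight = any-∩-all valid ↑.upperRight

      lowerLeft : Any LowerLeft R
      lowerLeft = Any.map (λ ((1+p<n , Pu) , left , below) → (1+p<n , Pu) , leftMove-upsideDown 1+p<n Pu left , below)
                    (any-∩-all valid (Any.map⁻ ↓.upperLeft))

      lowerRight : Any LowerRight R
      lowerRight = Any.map (λ (v , right , below) → v , leftMove-swapSides-upsideDown v right , below)
                     (any-∩-all valid (Any.map⁻ ↓.upperRight))

      topMove : ↑.c₁ ≡ n ∸ 1 → Any (ValidMove ∩ TopMove) R
      topMove c₁≡n-1 = any-∩-all valid (↑.top c₁≡n-1)

      bottomMove : ↓.c₁ ≡ n ∸ 1 → Any (ValidMove ∩ BottomMove) R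
      bottomMove e≡n-1 = any-∩-all valid (Any.map⁻ (↓.top e≡n-1))

      left⊆ : ∀ {X : Move → Set} → (ValidMove ∩ LeftMove ∩ X) ⊆ PerimeterMove
      left⊆ (v , left , _) = v , inj₁ left

      right⊆ : ∀ {X : Move → Set} → (ValidMove ∩ RightMove ∩ X) ⊆ PerimeterMove
      right⊆ (v , right , _) = v , inj₂ (inj₁ right)

      top⊆ : (ValidMove ∩ TopMove) ⊆ PerimeterMove
      top⊆ (v , top) = v , inj₂ (inj₂ (inj₁ top))

      bottom⊆ : (ValidMove ∩ BottomMove) ⊆ PerimeterMove
      bottom⊆ (v , bottom) = v , inj₂ (inj₂ (inj₂ bottom))

      left-right : ∀ {X Y : Move → Set} → Disjoint (ValidMove ∩ LeftMove ∩ X) (ValidMove ∩ RightMove ∩ Y)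
      left-right {x = m} ((v , left , _) , (_ , right , _)) = left-right-disjoint {m} v left right

      right-left : ∀ {X Y : Move → Set} → Disjoint (ValidMove ∩ RightMove ∩ X) (ValidMove ∩ LeftMove ∩ Y)
      right-left {x = m} ((v , right , _) , (_ , left , _)) = left-right-disjoint {m} v left right

    atLeastThree : AtLeast PerimeterMove 3 R
    atLeastThree with ↑.c₁≡n-1⊎c₁≤c′ | ↓.c₁≡n-1⊎c₁≤c′
    ... | inj₁ c₁≡n-1 | _ =
      any⇒atLeast3 top⊆ (left⊆ {NearFirst}) (right⊆ {NearLast})
        (λ {m} ((_ , top) , (_ , left , _)) → top-left-disjoint {m} top left)
        (λ {m} ((_ , top) , (_ , right , _)) → top-right-disjoint {m} top right)
        (left-right {NearFirst} {NearLast}) (topMove c₁≡n-1) upperLeft upperRight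
    ... | inj₂ _ | inj₁ e≡n-1 =
      any⇒atLeast3 bottom⊆ (left⊆ {NearFirst}) (right⊆ {NearLast})
        (λ {m} ((v , bottom) , (_ , left , _)) → bottom-left-disjoint {m} v bottom left)
        (λ {m} ((v , bottom) , (_ , right , _)) → bottom-right-disjoint {m} v bottom right)
        (left-right {NearFirst} {NearLast}) (bottomMove e≡n-1) upperLeft upperRight
    ... | inj₂ c₁≤c′ | inj₂ e≤f with ↑.c₁ + ↓.c₁ <? n
    ...   | yes c₁+e<n =
      any⇒atLeast3 (left⊆ {NearFirst}) (left⊆ {FarFirst}) (right⊆ {NearLast})
        (λ (((1+p<n , _) , _ , p<c₁) , (_ , _ , q<e)) → <⇒≱ c₁+e<n (above∩below⇒n≤c+e 1+p<n p<c₁ q<e))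
        (left-right {NearFirst} {NearLast}) (left-right {FarFirst} {NearLast}) upperLeft lowerLeft upperRight
    ...   | no c₁+e≮n =
      any⇒atLeast3 (right⊆ {NearLast}) (right⊆ {FarLast}) (left⊆ {NearFirst})
        (λ ((_ , _ , p<c′) , (_ , _ , q<f)) →
           <⇒≱ (≤-<-trans (+-mono-≤ c₁≤c′ e≤f) (above∩below⇒c+e<n p<c′ q<f)) (≮⇒≥ c₁+e≮n))
        (right-left {NearLast} {NearFirst}) (right-left {FarLast} {NearFirst}) upperRight lowerRight upperLeft

-- Paths of a tiling and the boundary of X(w)

-- The letter at position j of a path, as a number (0 past the end).
letterAt : ∀ {m k} → Vec (Fin m) k → ℕ → ℕ
letterAt []      _       = 0
letterAt (x ∷ u) zero    = toℕ x
letterAt (x ∷ u) (suc j) = letterAt u j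

letterAt-tabulate : ∀ {m k} (f : Fin k → Fin m) {j} (j<k : j < k) → letterAt (tabulate f) j ≡ toℕ (f (fromℕ< j<k))
letterAt-tabulate {k = suc k} f {zero}  _         = refl
letterAt-tabulate {k = suc k} f {suc j} (s≤s j<k) = letterAt-tabulate (f ∘ Fin.suc) j<k

∈-prefix⁻ : ∀ {m k} (u : Vec (Fin m) k) q {x} → x ∈ prefix u q → ∃ λ j → j < q × j < k × letterAt u j ≡ toℕ x
∈-prefix⁻ []      q       x∈ = ⊥-elim (∉⊥ x∈)
∈-prefix⁻ (y ∷ u) zero    x∈ = ⊥-elim (∉⊥ x∈)
∈-prefix⁻ (y ∷ u) (suc q) x∈ with x∈p∪q⁻ ⁅ y ⁆ (prefix u q) x∈
... | inj₁ x∈⁅y⁆ = 0 , s≤s z≤n , s≤s z≤n , cong toℕ (sym (x∈⁅y⁆⇒x≡y y x∈⁅y⁆))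
... | inj₂ x∈u with ∈-prefix⁻ u q x∈u
...   | j , j<q , j<k , uj≡x = suc j , s≤s j<q , s≤s j<k , uj≡x

∈-prefix⁺ : ∀ {m k} (u : Vec (Fin m) k) {q j x} → j < q → j < k → letterAt u j ≡ toℕ x → x ∈ prefix u q
∈-prefix⁺ (y ∷ u) {suc q} {zero}  _         _         y≡x =
  x∈p∪q⁺ (inj₁ (subst (_∈ ⁅ y ⁆) (toℕ-injective y≡x) (x∈⁅x⁆ y)))
∈-prefix⁺ (y ∷ u) {suc q} {suc j} (s≤s j<q) (s≤s j<k) uj≡x = x∈p∪q⁺ (inj₂ (∈-prefix⁺ u j<q j<k uj≡x))

record FlipAt {m k} (u v : Vec (Fin m) k) (S : Subset m) (a b : Fin m) (p : ℕ) : Set where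
  field
    in-range : suc p < k
    a-at-p   : letterAt u p ≡ toℕ a
    b-at-1+p : letterAt u (suc p) ≡ toℕ b
    a<b      : toℕ a < toℕ b
    swapped  : ∀ j → letterAt v j ≡ letterAt u (swapAt p j)
    S≡u      : S ≡ prefix u p
    S≡v      : S ≡ prefix v p
    a∪S≡u    : ⁅ a ⁆ ∪ S ≡ prefix u (suc p)
    b∪S≡v    : ⁅ b ⁆ ∪ S ≡ prefix v (suc p)

flip⇒flipAt : ∀ {m k} {u v : Vec (Fin m) k} {S a b} → Flip u v S a b → ∃ (FlipAt u v S a b)
flip⇒flipAt {u = a ∷ b ∷ w} (here a<b) = 0 , record
  { in-range = s≤s (s≤s z≤n) ; a-at-p = refl ; b-at-1+p = refl ; a<b = a<b ; swapped = swapped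
  ; S≡u = refl ; S≡v = refl ; a∪S≡u = refl ; b∪S≡v = refl }
  where
  swapped : ∀ j → letterAt (b ∷ a ∷ w) j ≡ letterAt (a ∷ b ∷ w) (swapAt 0 j)
  swapped 0             = cong (letterAt (a ∷ b ∷ w)) (sym (swapAt-here 0))
  swapped 1             = cong (letterAt (a ∷ b ∷ w)) (sym (swapAt-next 0))
  swapped (suc (suc j)) = cong (letterAt (a ∷ b ∷ w)) (sym (swapAt-other {0} {suc (suc j)} (λ ()) (λ ())))
flip⇒flipAt {u = x ∷ u} {x ∷ v} {a = a} {b} (there flip) with flip⇒flipAt flip
... | p , φ = suc p , record
  { in-range = s≤s in-range ; a-at-p = a-at-p ; b-at-1+p = b-at-1+p ; a<b = a<b ; swapped = swapped′
  ; S≡u = cong (⁅ x ⁆ ∪_) S≡u ; S≡v = cong (⁅ x ⁆ ∪_) S≡v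
  ; a∪S≡u = trans (∪-left-comm ⁅ a ⁆ ⁅ x ⁆ _) (cong (⁅ x ⁆ ∪_) a∪S≡u)
  ; b∪S≡v = trans (∪-left-comm ⁅ b ⁆ ⁅ x ⁆ _) (cong (⁅ x ⁆ ∪_) b∪S≡v) }
  where
  open FlipAt φ
  ∪-left-comm : ∀ {m} (A B C : Subset m) → A ∪ (B ∪ C) ≡ B ∪ (A ∪ C)
  ∪-left-comm A B C = trans (sym (∪-assoc A B C)) (trans (cong (_∪ C) (∪-comm A B)) (∪-assoc B A C))
  swapped′ : ∀ j → letterAt (x ∷ v) j ≡ letterAt (x ∷ u) (swapAt (suc p) j)
  swapped′ zero    = cong (letterAt (x ∷ u)) (sym (swapAt-zero {suc p} (λ ())))
  swapped′ (suc j) = trans (swapped j) (cong (letterAt (x ∷ u)) (sym (swapAt-suc p j)))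

private
  T-⌊⌋∧⌊⌋⁺ : ∀ {A B : Set} (a? : Dec A) (b? : Dec B) → A → B → T (⌊ a? ⌋ ∧ ⌊ b? ⌋)
  T-⌊⌋∧⌊⌋⁺ (yes _) (yes _) _ _ = _
  T-⌊⌋∧⌊⌋⁺ (no ¬a) _       a _ = ¬a a
  T-⌊⌋∧⌊⌋⁺ (yes _) (no ¬b) _ b = ¬b b

  T-⌊⌋∧⌊⌋⁻ : ∀ {A B : Set} (a? : Dec A) (b? : Dec B) → T (⌊ a? ⌋ ∧ ⌊ b? ⌋) → A × B
  T-⌊⌋∧⌊⌋⁻ (yes a) (yes b) _ = a , b
  T-⌊⌋∧⌊⌋⁻ (yes _) (no _)  ()
  T-⌊⌋∧⌊⌋⁻ (no _)  _       ()

  T-∨⁻ : ∀ x {y} → T (x ∨ y) → T x ⊎ T y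
  T-∨⁻ true  _  = inj₁ _
  T-∨⁻ false ty = inj₂ ty

  sameEdge : ∀ {m} (u : Vec (Fin m) m) k →
             T ((prefix u (toℕ k) ≟S prefix u (toℕ k)) ∧ ⌊ lookup u k Fin.≟ lookup u k ⌋)
  sameEdge u k =
    T-⌊⌋∧⌊⌋⁺ (≡-dec Bool._≟_ (prefix u (toℕ k)) (prefix u (toℕ k))) (lookup u k Fin.≟ lookup u k) refl refl

leftSide-boundaryEdge : ∀ {m} (w : Permutation′ m) (k : Fin m) →
                        T (boundaryEdge w (prefix (idWord m) (toℕ k) , lookup (idWord m) k))
leftSide-boundaryEdge {m} w k =
  Any.any⁺ _ (Any.map (λ { refl → Equivalence.from T-∨ (inj₁ (sameEdge (idWord m) k)) }) (∈-allFin k))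

rightSide-boundaryEdge : ∀ {m} (w : Permutation′ m) (k : Fin m) →
                         T (boundaryEdge w (prefix (word w) (toℕ k) , lookup (word w) k))
rightSide-boundaryEdge w k =
  Any.any⁺ _ (Any.map (λ { refl → Equivalence.from T-∨ (inj₂ (sameEdge (word w) k)) }) (∈-allFin k))

boundaryEdge-sound : ∀ {m} (w : Permutation′ m) {S c} → T (boundaryEdge w (S , c)) →
                     ∃ λ k → (S ≡ prefix (idWord m) (toℕ k) × c ≡ lookup (idWord m) k) ⊎
                             (S ≡ prefix (word w) (toℕ k) × c ≡ lookup (word w) k)
boundaryEdge-sound {m} w {S} {c} onBoundary with Any.satisfied (Any.any⁻ _ (List.allFin m) onBoundary)
... | k , onPath =
  k , Sum.map (T-⌊⌋∧⌊⌋⁻ (≡-dec Bool._≟_ _ _) (c Fin.≟ _)) (T-⌊⌋∧⌊⌋⁻ (≡-dec Bool._≟_ _ _) (c Fin.≟ _))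
                             (T-∨⁻ ((S ≟S prefix (idWord m) (toℕ k)) ∧ ⌊ c Fin.≟ lookup (idWord m) k ⌋) onPath)

consecutive⇒T : ∀ {e₁ e₂ e₃ e₄} → (T e₁ × T e₂) ⊎ (T e₂ × T e₃) ⊎ (T e₃ × T e₄) ⊎ (T e₄ × T e₁) →
                T ((e₁ ∧ e₂) ∨ (e₂ ∧ e₃) ∨ (e₃ ∧ e₄) ∨ (e₄ ∧ e₁))
consecutive⇒T = ∨-intro ∘ Sum.map ∧-intro (∨-intro ∘ Sum.map ∧-intro (∨-intro ∘ Sum.map ∧-intro ∧-intro))
  where
  ∧-intro : ∀ {x y} → T x × T y → T (x ∧ y)
  ∧-intro = Equivalence.from T-∧
  ∨-intro : ∀ {x y} → T x ⊎ T y → T (x ∨ y)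
  ∨-intro = Equivalence.from T-∨

¬consecutive : ∀ {e₁ e₂ e₃ e₄} → ¬ T e₁ → ¬ T e₃ → ¬ T ((e₁ ∧ e₂) ∨ (e₂ ∧ e₃) ∨ (e₃ ∧ e₄) ∨ (e₄ ∧ e₁))
¬consecutive {true}                          ¬e₁ _   _ = ¬e₁ _
¬consecutive {false} {_}     {true}          _   ¬e₃ _ = ¬e₃ _
¬consecutive {false} {false} {false} {false} _   _   ()
¬consecutive {false} {false} {false} {true}  _   _   ()
¬consecutive {false} {true}  {false} {false} _   _   ()
¬consecutive {false} {true}  {false} {true}  _   _   ()

perim≤perim-∷ : ∀ {m} (w : Permutation′ m) t Ts → perim w Ts ≤ perim w (t ∷ Ts)
perim≤perim-∷ w t Ts with isPerimeter w t
... | true  = n≤1+n _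
... | false = ≤-refl

perim-∷≤ : ∀ {m} (w : Permutation′ m) t Ts → perim w (t ∷ Ts) ≤ suc (perim w Ts)
perim-∷≤ w t Ts with isPerimeter w t
... | true  = ≤-refl
... | false = n≤1+n _

perim-∷-perimeter : ∀ {m} (w : Permutation′ m) t Ts → T (isPerimeter w t) → perim w (t ∷ Ts) ≡ suc (perim w Ts)
perim-∷-perimeter w t Ts isPerim with isPerimeter w t
... | true = refl

atLeast⇒≤perim : ∀ {m} {w : Permutation′ m} {A : Set} {Q : A → Set} {_∼_ : Tile m → A → Set} →
                 (∀ {t x} → t ∼ x → Q x → T (isPerimeter w t)) →
                 ∀ {k Ts xs} → AtLeast Q k xs → Pointwise _∼_ Ts xs → k ≤ perim w Ts
atLeast⇒≤perim perimeter [] _ = z≤n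
atLeast⇒≤perim {w = w} perimeter (skip picked) (_∷_ {x = t} {xs = Ts} _ related) =
  ≤-trans (atLeast⇒≤perim perimeter picked related) (perim≤perim-∷ w t Ts)
atLeast⇒≤perim {w = w} perimeter (take q picked) (_∷_ {x = t} {xs = Ts} t∼x related) =
  subst (_ ≤_) (sym (perim-∷-perimeter w t Ts (perimeter t∼x q))) (s≤s (atLeast⇒≤perim perimeter picked related))

perim-++ : ∀ {m} (w : Permutation′ m) Ts Us → perim w (Ts ++ Us) ≡ perim w Ts + perim w Us
perim-++ w []       Us = refl
perim-++ w (t ∷ Ts) Us with isPerimeter w t
... | true  = cong suc (perim-++ w Ts Us)
... | false = perim-++ w Ts Us

perim-none : ∀ {m} (w : Permutation′ m) {Ts} → All (λ t → ¬ T (isPerimeter w t)) Ts → perim w Ts ≡ 0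
perim-none w [] = refl
perim-none w (_∷_ {x = t} ¬perimeter rest) with isPerimeter w t
... | true  = ⊥-elim (¬perimeter _)
... | false = perim-none w rest

perim-singleton≤1 : ∀ {m} (w : Permutation′ m) t → perim w [ t ] ≤ 1
perim-singleton≤1 w t with isPerimeter w t
... | true  = ≤-refl
... | false = z≤n

tabulate-∷ʳ : ∀ {A : Set} {k} (f : Fin (suc k) → A) →
              List.tabulate f ≡ List.tabulate (f ∘ Fin.inject₁) ∷ʳ f (Fin.fromℕ k)
tabulate-∷ʳ {k = zero}  f = refl
tabulate-∷ʳ {k = suc k} f = cong (f Fin.zero ∷_) (tabulate-∷ʳ (f ∘ Fin.suc))

tabulateᵥ-∷ʳ : ∀ {A : Set} {k} (f : Fin (suc k) → A) →
               tabulate f ≡ tabulate (f ∘ Fin.inject₁) Vec.∷ʳ f (Fin.fromℕ k)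
tabulateᵥ-∷ʳ {k = zero}  f = refl
tabulateᵥ-∷ʳ {k = suc k} f = cong (f Fin.zero ∷_) (tabulateᵥ-∷ʳ (f ∘ Fin.suc))

perim-tabulate≤2 : ∀ {m} (w : Permutation′ m) {k} (g : Fin k → Tile m) →
                   (∀ i → 0 < toℕ i → suc (toℕ i) < k → ¬ T (isPerimeter w (g i))) → perim w (List.tabulate g) ≤ 2
perim-tabulate≤2 w {zero}        g _     = z≤n
perim-tabulate≤2 w {suc zero}    g _     = ≤-trans (perim-singleton≤1 w (g Fin.zero)) (n≤1+n 1)
perim-tabulate≤2 w {suc (suc k)} g inner = begin
  perim w (g Fin.zero ∷ List.tabulate (g ∘ Fin.suc))  ≤⟨ perim-∷≤ w (g Fin.zero) (List.tabulate (g ∘ Fin.suc)) ⟩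
  suc (perim w (List.tabulate (g ∘ Fin.suc)))          ≡⟨ cong (suc ∘ perim w) (tabulate-∷ʳ (g ∘ Fin.suc)) ⟩
  suc (perim w (middle ∷ʳ last))                       ≡⟨ cong suc (perim-++ w middle [ last ]) ⟩
  suc (perim w middle + perim w [ last ])              ≡⟨ cong (λ x → suc (x + perim w [ last ])) (perim-none w {middle} middle-inner) ⟩
  suc (perim w [ last ])                               ≤⟨ s≤s (perim-singleton≤1 w last) ⟩
  2                                                    ∎
  where
  open ≤-Reasoning
  middle = List.tabulate (g ∘ Fin.suc ∘ Fin.inject₁)
  last = g (Fin.suc (Fin.fromℕ k))
  middle-inner : All (λ t → ¬ T (isPerimeter w t)) middle
  middle-inner = All.tabulate⁺ {f = g ∘ Fin.suc ∘ Fin.inject₁} λ j →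
    inner (Fin.suc (Fin.inject₁ j)) (s≤s z≤n) (s≤s (s≤s (subst (_< k) (sym (toℕ-inject₁ j)) (toℕ<n j))))

module ReverseTilings (n : ℕ) (2<n : 2 < n) where
  open Words n
  open ReverseSweeps n 2<n

  w₀ : Permutation′ n
  w₀ = reverse {n}

  letterAt-idWord : ∀ {j} → j < n → letterAt (idWord n) j ≡ j
  letterAt-idWord j<n = trans (letterAt-tabulate id j<n) (toℕ-fromℕ< j<n)

  letterAt-w₀ : ∀ {j} → j < n → letterAt (word w₀) j ≡ opposite j
  letterAt-w₀ j<n = trans (letterAt-tabulate (w₀ ⟨$⟩ʳ_) j<n) (trans (opposite-prop _) (cong opposite (toℕ-fromℕ< j<n)))

  record RanksPrefixes (side : Vec (Fin n) n) (r : ℕ → ℕ) : Set where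
    field
      ranked : ∀ {q x} → x ∈ prefix side q → r (toℕ x) < q
      member : ∀ {q x} → r (toℕ x) < q → x ∈ prefix side q

  ranksPrefixes : ∀ side {r} → (∀ {j} → j < n → r (letterAt side j) ≡ j) → (∀ {x} → x < n → r x < n) →
                  (∀ {x} → x < n → letterAt side (r x) ≡ x) → RanksPrefixes side r
  ranksPrefixes side {r} rank-letter r-< letter-rank = record { ranked = ranked ; member = member }
    where
    ranked : ∀ {q x} → x ∈ prefix side q → r (toℕ x) < q
    ranked {q} x∈ with ∈-prefix⁻ side q x∈
    ... | j , j<q , j<n , sj≡x = subst (_< q) (trans (sym (rank-letter j<n)) (cong r sj≡x)) j<q
    member : ∀ {q x} → r (toℕ x) < q → x ∈ prefix side q
    member {x = x} rx<q = ∈-prefix⁺ side rx<q (r-< (toℕ<n x)) (letter-rank (toℕ<n x))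

  ranksPrefixes-idWord : RanksPrefixes (idWord n) id
  ranksPrefixes-idWord = ranksPrefixes (idWord n) letterAt-idWord id letterAt-idWord

  ranksPrefixes-w₀ : RanksPrefixes (word w₀) opposite
  ranksPrefixes-w₀ = ranksPrefixes (word w₀) (λ j<n → trans (cong opposite (letterAt-w₀ j<n)) (opposite-involutive j<n))
                       opposite-< (λ x<n → trans (letterAt-w₀ (opposite-< x<n)) (opposite-involutive x<n))

  prefix≡side : ∀ {side r} (path : Vec (Fin n) n) {q} → RanksPrefixes side r → IsPermutation (letterAt path) →
                EdgeAlong r (letterAt path) q → prefix path q ≡ prefix side q
  prefix≡side {side} {r} path {q} ranks P along = ⊆-antisym to from
    where
    open EdgeAlong along
    open RanksPrefixes ranks
    to : ∀ {x} → x ∈ prefix path q → x ∈ prefix side q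
    to x∈ with ∈-prefix⁻ path q x∈
    ... | j , j<q , _ , pj≡x = member (subst (λ y → r y < q) pj≡x (ranked-before j j<q))
    from : ∀ {x} → x ∈ prefix side q → x ∈ prefix path q
    from {x} x∈ with surjective P (toℕ x) (toℕ<n x)
    ... | j , j<n , pj≡x =
      ∈-prefix⁺ path (before-ranked j j<n (subst (λ y → r y < q) (sym pj≡x) (ranked x∈))) j<n pj≡x

  leftEdge-boundaryEdge : ∀ (path : Vec (Fin n) n) {q S c} → IsPermutation (letterAt path) → (q<n : q < n) →
                          EdgeAlong id (letterAt path) q → S ≡ prefix path q → toℕ c ≡ letterAt path q →
                          T (boundaryEdge w₀ (S , c))
  leftEdge-boundaryEdge path {q} P q<n along S≡ c≡ =
    subst₂ (λ S c → T (boundaryEdge w₀ (S , c))) S≡k c≡k (leftSide-boundaryEdge w₀ k)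
    where
    k = fromℕ< q<n
    S≡k : prefix (idWord n) (toℕ k) ≡ _
    S≡k = trans (cong (prefix (idWord n)) (toℕ-fromℕ< q<n))
                (trans (sym (prefix≡side path ranksPrefixes-idWord P along)) (sym S≡))
    c≡k : lookup (idWord n) k ≡ _
    c≡k = toℕ-injective (trans (cong toℕ (lookup-allFin k))
                          (trans (toℕ-fromℕ< q<n) (trans (sym (EdgeAlong.rank-at along)) (sym c≡))))

  rightEdge-boundaryEdge : ∀ (path : Vec (Fin n) n) {q S c} → IsPermutation (letterAt path) → (q<n : q < n) →
                           EdgeAlong opposite (letterAt path) q → S ≡ prefix path q → toℕ c ≡ letterAt path q →
                           T (boundaryEdge w₀ (S , c))
  rightEdge-boundaryEdge path {q} P q<n along S≡ c≡ =
    subst₂ (λ S c → T (boundaryEdge w₀ (S , c))) S≡k c≡k (rightSide-boundaryEdge w₀ k)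
    where
    k = fromℕ< q<n
    S≡k : prefix (word w₀) (toℕ k) ≡ _
    S≡k = trans (cong (prefix (word w₀)) (toℕ-fromℕ< q<n))
                (trans (sym (prefix≡side path ranksPrefixes-w₀ P along)) (sym S≡))
    c≡k : lookup (word w₀) k ≡ _
    c≡k = toℕ-injective (begin
      toℕ (lookup (word w₀) k)              ≡⟨ cong toℕ (lookup∘tabulate (w₀ ⟨$⟩ʳ_) k) ⟩
      toℕ (w₀ ⟨$⟩ʳ k)                       ≡⟨ opposite-prop k ⟩
      opposite (toℕ k)                      ≡⟨ cong opposite (toℕ-fromℕ< q<n) ⟩
      opposite q                            ≡⟨ cong opposite (sym (EdgeAlong.rank-at along)) ⟩
      opposite (opposite (letterAt path q)) ≡⟨ opposite-involutive (bounded P q q<n) ⟩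
      letterAt path q                       ≡⟨ sym c≡ ⟩
      toℕ _                                 ∎)
      where open ≡-Reasoning

  TileMove : Tile n → Move → Set
  TileMove (tile S a b) (u , p) =
    ∃ λ (before : Vec (Fin n) n) → ∃ λ after → u ≡ letterAt before × FlipAt before after S a b p

  sweep⇒flips : ∀ {t u : Vec (Fin n) n} {Ts} → Sweep t u Ts →
                ∃ λ R → Flips (letterAt u) (letterAt t) R × Pointwise TileMove Ts R
  sweep⇒flips done = [] , done (λ _ _ → refl) , []
  sweep⇒flips {u = u} (step {v = v} flip sweep) with flip⇒flipAt flip | sweep⇒flips sweep
  ... | p , φ | R , flips , related =
    (letterAt u , p) ∷ R ,
    step in-range (subst₂ _<_ (sym a-at-p) (sym b-at-1+p) a<b) (λ j _ → swapped j) flips ,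
    (u , v , refl , φ) ∷ related
    where open FlipAt φ

  tileMove-perimeter : ∀ {t m} → TileMove t m → PerimeterMove m → T (isPerimeter w₀ t)
  tileMove-perimeter {tile S a b} {._ , p} (before , after , refl , φ) perimeterMove@((_ , P) , _) =
    consecutive⇒T (Sum.map edges₁₂ (Sum.map edges₂₃ (Sum.map edges₃₄ edges₄₁))
                           (perimeterMove⇒edgesAlong perimeterMove))
    where
    open FlipAt φ
    p<n = 1+p<n⇒p<n in-range
    P′ : IsPermutation (letterAt after)
    P′ = isPermutation-resp-≈ (isPermutation-swap p in-range P) (λ j _ → swapped j)
    after≗ : ∀ j → swap p (letterAt before) j ≡ letterAt after j
    after≗ j = sym (swapped j)
    a-at-1+p′ : toℕ a ≡ letterAt after (suc p)
    a-at-1+p′ = trans (sym a-at-p) (trans (cong (letterAt before) (sym (swapAt-next p))) (after≗ (suc p)))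
    b-at-p′ : toℕ b ≡ letterAt after p
    b-at-p′ = trans (sym b-at-1+p) (trans (cong (letterAt before) (sym (swapAt-here p))) (after≗ p))
    e₁ : EdgeAlong id (letterAt before) p → T (boundaryEdge w₀ (S , a))
    e₁ along = leftEdge-boundaryEdge before P p<n along S≡u (sym a-at-p)
    e₂ : EdgeAlong id (letterAt before) (suc p) → T (boundaryEdge w₀ (⁅ a ⁆ ∪ S , b))
    e₂ along = leftEdge-boundaryEdge before P in-range along a∪S≡u (sym b-at-1+p)
    e₃ : EdgeAlong opposite (swap p (letterAt before)) (suc p) → T (boundaryEdge w₀ (⁅ b ⁆ ∪ S , a))
    e₃ along = rightEdge-boundaryEdge after P′ in-range (edgeAlong-resp-≗ after≗ along) b∪S≡v a-at-1+p′
    e₄ : EdgeAlong opposite (swap p (letterAt before)) p → T (boundaryEdge w₀ (S , b))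
    e₄ along = rightEdge-boundaryEdge after P′ p<n (edgeAlong-resp-≗ after≗ along) S≡v b-at-p′
    edges₁₂ = Product.map e₁ e₂
    edges₂₃ = Product.map e₂ e₃
    edges₃₄ = Product.map e₃ e₄
    edges₄₁ = Product.map e₄ e₁

  3≤perim : ∀ Ts → IsTiling w₀ Ts → 3 ≤ perim w₀ Ts
  3≤perim Ts tiling with sweep⇒flips tiling
  ... | R , flips , related =
    atLeast⇒≤perim tileMove-perimeter
      (ThreePerimeterMoves.atLeastThree flips P₀ (λ _ → letterAt-idWord) (λ _ → letterAt-w₀)) related
    where
    P₀ : IsPermutation (letterAt (idWord n))
    P₀ = isPermutation-resp-≈ isPermutation-id (λ _ → letterAt-idWord)

-- The strip of rhombi carrying the label 1 from the top to the bottom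

-- Sweep for paths of any length, so that a common first letter can be added to a sweep.
data PathSweep {m k} (t : Vec (Fin m) k) : Vec (Fin m) k → List (Tile m) → Set where
  done : PathSweep t t []
  step : ∀ {u v S a b Ts} → Flip u v S a b → PathSweep t v Ts → PathSweep t u (tile S a b ∷ Ts)

pathSweep⇒sweep : ∀ {m} {t u : Vec (Fin m) m} {Ts} → PathSweep t u Ts → Sweep t u Ts
pathSweep⇒sweep done = done
pathSweep⇒sweep (step flip sweep) = step flip (pathSweep⇒sweep sweep)

liftTile : ∀ {m} → Fin m → Tile m → Tile m
liftTile y (tile S a b) = tile (⁅ y ⁆ ∪ S) a b

pathSweep-∷ : ∀ {m k} {t u : Vec (Fin m) k} {Ts} y → PathSweep t u Ts → PathSweep (y ∷ t) (y ∷ u) (map (liftTile y) Ts)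
pathSweep-∷ y done = done
pathSweep-∷ y (step flip sweep) = step (there flip) (pathSweep-∷ y sweep)

zeroTiles : ∀ {A k} → Vec (Fin (suc A)) k → List (Tile (suc A))
zeroTiles []      = []
zeroTiles (y ∷ v) = tile Subset.⊥ Fin.zero y ∷ map (liftTile y) (zeroTiles v)

pathSweep-zero : ∀ {A k} (v : Vec (Fin (suc A)) k) → (∀ i → Fin.zero {A} Fin.< lookup v i) →
                 PathSweep (v Vec.∷ʳ Fin.zero) (Fin.zero ∷ v) (zeroTiles v)
pathSweep-zero []      _        = done
pathSweep-zero (y ∷ v) positive =
  step (here (positive Fin.zero)) (pathSweep-∷ y (pathSweep-zero v (positive ∘ Fin.suc)))

zeroTiles-tabulate : ∀ {A k} (v : Vec (Fin (suc A)) k) →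
                     zeroTiles v ≡ List.tabulate (λ i → tile (prefix v (toℕ i)) Fin.zero (lookup v i))
zeroTiles-tabulate []      = refl
zeroTiles-tabulate (y ∷ v) =
  cong (tile Subset.⊥ Fin.zero y ∷_) (trans (cong (map (liftTile y)) (zeroTiles-tabulate v)) (List.map-tabulate _ _))

-- The cycle 2 3 … (A + 1) 1, that is, i ↦ i + 1 modulo A + 1 on Fin (suc A).
module Cycle (A : ℕ) where

  next : Fin (suc A) → Fin (suc A)
  next i with Top.view i
  ... | Top.‵fromℕ     = Fin.zero
  ... | Top.‵inject₁ j = Fin.suc j

  previous : Fin (suc A) → Fin (suc A)
  previous Fin.zero    = Fin.fromℕ A
  previous (Fin.suc j) = Fin.inject₁ j

  next-fromℕ : next (Fin.fromℕ A) ≡ Fin.zero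
  next-fromℕ rewrite Top.view-fromℕ A = refl

  next-inject₁ : ∀ j → next (Fin.inject₁ j) ≡ Fin.suc j
  next-inject₁ j rewrite Top.view-inject₁ j = refl

  next-previous : ∀ i → next (previous i) ≡ i
  next-previous Fin.zero    = next-fromℕ
  next-previous (Fin.suc j) = next-inject₁ j

  previous-next : ∀ i → previous (next i) ≡ i
  previous-next i with Top.view i
  ... | Top.‵fromℕ     = refl
  ... | Top.‵inject₁ j = refl

  cycle : Permutation′ (suc A)
  cycle = permutation next previous next-previous previous-next

  toℕ-next : ∀ i → toℕ i < A → toℕ (next i) ≡ suc (toℕ i)
  toℕ-next i i<A with Top.view i
  ... | Top.‵fromℕ     = ⊥-elim (<-irrefl (toℕ-fromℕ A) i<A)
  ... | Top.‵inject₁ j = cong suc (sym (toℕ-inject₁ j))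

  letters : Vec (Fin (suc A)) A
  letters = tabulate Fin.suc

  word-cycle : word cycle ≡ letters Vec.∷ʳ Fin.zero
  word-cycle = trans (tabulateᵥ-∷ʳ next) (cong₂ Vec._∷ʳ_ (Vec.tabulate-cong next-inject₁) next-fromℕ)

  strip : List (Tile (suc A))
  strip = zeroTiles letters

  strip-tiling : IsTiling cycle strip
  strip-tiling = subst (λ t → Sweep t (idWord (suc A)) strip) (sym word-cycle)
    (pathSweep⇒sweep (pathSweep-zero letters
      (λ i → subst (Fin.zero {A} Fin.<_) (sym (lookup∘tabulate Fin.suc i)) (s≤s z≤n))))

  letterAt-letters : ∀ {j} → j < A → letterAt letters j ≡ suc j
  letterAt-letters j<A = trans (letterAt-tabulate Fin.suc j<A) (cong suc (toℕ-fromℕ< j<A))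

  letterAt-cycle : ∀ {j} → j < A → letterAt (word cycle) j ≡ suc j
  letterAt-cycle {j} j<A =
    trans (letterAt-tabulate next (m<n⇒m<1+n j<A))
          (trans (toℕ-next _ (subst (_< A) (sym (toℕ-fromℕ< _)) j<A)) (cong suc (toℕ-fromℕ< _)))

  fromℕ∈prefix-cycle : 1 ≤ A → Fin.fromℕ A ∈ prefix (word cycle) A
  fromℕ∈prefix-cycle 1≤A = ∈-prefix⁺ (word cycle) A∸1<A (m<n⇒m<1+n A∸1<A)
    (trans (letterAt-cycle A∸1<A) (trans 1+[A∸1]≡A (sym (toℕ-fromℕ A))))
    where
    1+[A∸1]≡A : suc (A ∸ 1) ≡ A
    1+[A∸1]≡A = trans (+-comm 1 (A ∸ 1)) (m∸n+n≡m 1≤A)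
    A∸1<A : A ∸ 1 < A
    A∸1<A = subst (A ∸ 1 <_) 1+[A∸1]≡A (n<1+n (A ∸ 1))

  -- The only edges labelled 1 on the boundary of X(cycle) are the first edge of the left side
  -- and the last edge of the right side.
  zeroEdge-¬boundary : ∀ {S x} → 1 ≤ A → x ∈ S → (∀ {y} → y ∈ S → toℕ y < A) →
                       ¬ T (boundaryEdge cycle (S , Fin.zero))
  zeroEdge-¬boundary {S} {x} 1≤A x∈S below onBoundary with boundaryEdge-sound cycle onBoundary
  ... | k , inj₁ (S≡ , 0≡k) with trans 0≡k (lookup-allFin k)
  ...   | refl = ∉⊥ (subst (x ∈_) S≡ x∈S)
  zeroEdge-¬boundary {S} {x} 1≤A x∈S below onBoundary | k , inj₂ (S≡ , 0≡k′)
    with Top.view k | trans 0≡k′ (lookup∘tabulate next k)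
  ... | Top.‵fromℕ | _ =
    <-irrefl (toℕ-fromℕ A) (below (subst (Fin.fromℕ A ∈_) prefix≡S (fromℕ∈prefix-cycle 1≤A)))
    where
    prefix≡S : prefix (word cycle) A ≡ S
    prefix≡S = trans (cong (prefix (word cycle)) (sym (toℕ-fromℕ A))) (sym S≡)
  ... | Top.‵inject₁ j | ()

  middleTile-¬perimeter : ∀ (i : Fin A) → 0 < toℕ i → suc (toℕ i) < A →
                          ¬ T (isPerimeter cycle (tile (prefix letters (toℕ i)) Fin.zero (lookup letters i)))
  middleTile-¬perimeter i 0<i 1+i<A =
    ¬consecutive (zeroEdge-¬boundary 1≤A one∈S S<A) (zeroEdge-¬boundary 1≤A (x∈p∪q⁺ (inj₂ one∈S)) b∪S<A)
    where
    S = prefix letters (toℕ i)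
    1≤A : 1 ≤ A
    1≤A = ≤-trans (s≤s z≤n) 1+i<A
    one∈S : Fin.suc (fromℕ< 1≤A) ∈ S
    one∈S = ∈-prefix⁺ letters 0<i 1≤A (letterAt-tabulate Fin.suc 1≤A)
    S<A : ∀ {y} → y ∈ S → toℕ y < A
    S<A y∈S with ∈-prefix⁻ letters (toℕ i) y∈S
    ... | j , j<i , j<A , letter≡y = subst (_< A) (trans (sym (letterAt-letters j<A)) letter≡y) (<-trans (s≤s j<i) 1+i<A)
    b∪S<A : ∀ {y} → y ∈ ⁅ lookup letters i ⁆ ∪ S → toℕ y < A
    b∪S<A {y} y∈ with x∈p∪q⁻ ⁅ lookup letters i ⁆ S y∈
    ... | inj₁ y∈⁅b⁆ =
      subst (_< A) (cong toℕ (sym (trans (x∈⁅y⁆⇒x≡y _ y∈⁅b⁆) (lookup∘tabulate Fin.suc i)))) 1+i<A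
    ... | inj₂ y∈S = S<A y∈S

  perim-strip≤2 : perim cycle strip ≤ 2
  perim-strip≤2 = subst (λ Ts → perim cycle Ts ≤ 2) (sym (zeroTiles-tabulate letters))
                    (perim-tabulate≤2 cycle _ middleTile-¬perimeter)

  cycle-admissible : 1 ≤ A → ElnitskyAdmissible cycle
  cycle-admissible 1≤A = s≤s 1≤A , λ r 0<r r<1+A prefixes≡ →
    zero∉prefix r<1+A (subst (Fin.zero ∈_) (sym prefixes≡) (∈-prefix⁺ (idWord (suc A)) 0<r (s≤s z≤n) refl))
    where
    zero∉prefix : ∀ {r} → r < suc A → ¬ Fin.zero ∈ prefix (word cycle) r
    zero∉prefix r<1+A zero∈ with ∈-prefix⁻ (word cycle) _ zero∈
    ... | j , j<r , _ , letter≡0 with trans (sym (letterAt-cycle (<-≤-trans j<r (≤-pred r<1+A)))) letter≡0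
    ...   | ()

  private
    Inversion : Fin (suc A) × Fin (suc A) → Set
    Inversion (i , j) = i Fin.< j × cycle ⟨$⟩ʳ j Fin.< cycle ⟨$⟩ʳ i

    ascending? = λ (p : Fin (suc A) × Fin (suc A)) → proj₁ p Fin.<? proj₂ p
    inverted?  = λ (p : Fin (suc A) × Fin (suc A)) → (cycle ⟨$⟩ʳ proj₂ p) Fin.<? (cycle ⟨$⟩ʳ proj₁ p)

    inversions : List (Fin (suc A) × Fin (suc A)) → ℕ
    inversions ps = List.length (List.filter inverted? (List.filter ascending? ps))

    inversions-++ : ∀ ps qs → inversions (ps ++ qs) ≡ inversions ps + inversions qs
    inversions-++ ps qs rewrite List.filter-++ ascending? ps qs
                              | List.filter-++ inverted? (List.filter ascending? ps) (List.filter ascending? qs) =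
      List.length-++ (List.filter inverted? (List.filter ascending? ps))

    inversions-∷-¬ : ∀ p ps → ¬ Inversion p → inversions (p ∷ ps) ≡ inversions ps
    inversions-∷-¬ p ps ¬inv with ascending? p
    ... | no ¬asc rewrite List.filter-reject ascending? {p} {ps} ¬asc = refl
    ... | yes asc rewrite List.filter-accept ascending? {p} {ps} asc
                        | List.filter-reject inverted? {p} {List.filter ascending? ps} (λ inv → ¬inv (asc , inv)) = refl

    inversions-[_] : ∀ p → Inversion p → inversions [ p ] ≡ 1
    inversions-[_] p (asc , inv) rewrite List.filter-accept ascending? {p} {[]} asc
                                       | List.filter-accept inverted? {p} {[]} inv = refl

    inversions-none : ∀ {ps} → All (¬_ ∘ Inversion) ps → inversions ps ≡ 0
    inversions-none []                   = refl
    inversions-none (_∷_ {x = p} {xs = ps} ¬inv rest) = trans (inversions-∷-¬ p ps ¬inv) (inversions-none rest)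

    cartesianProduct-++ : ∀ (xs ys zs : List (Fin (suc A))) →
                          List.cartesianProduct (xs ++ ys) zs ≡ List.cartesianProduct xs zs ++ List.cartesianProduct ys zs
    cartesianProduct-++ []       ys zs = refl
    cartesianProduct-++ (x ∷ xs) ys zs =
      trans (cong (map (x ,_) zs ++_) (cartesianProduct-++ xs ys zs)) (sym (List.++-assoc (map (x ,_) zs) _ _))

    positions : List (Fin (suc A))
    positions = List.allFin (suc A)

    positions-∷ʳ : positions ≡ List.tabulate Fin.inject₁ ∷ʳ Fin.fromℕ A
    positions-∷ʳ = tabulate-∷ʳ id

    -- Only the last letter, 0, is smaller than an earlier one.
    row-inject₁ : ∀ (i : Fin A) → inversions (map (Fin.inject₁ i ,_) positions) ≡ 1
    row-inject₁ i = begin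
      inversions (map (Fin.inject₁ i ,_) positions)
        ≡⟨ cong (inversions ∘ map (Fin.inject₁ i ,_)) positions-∷ʳ ⟩
      inversions (map (Fin.inject₁ i ,_) (List.tabulate Fin.inject₁ ∷ʳ Fin.fromℕ A))
        ≡⟨ cong inversions (List.map-++ (Fin.inject₁ i ,_) (List.tabulate Fin.inject₁) _) ⟩
      inversions (map (Fin.inject₁ i ,_) (List.tabulate Fin.inject₁) ++ [ Fin.inject₁ i , Fin.fromℕ A ])
        ≡⟨ inversions-++ (map (Fin.inject₁ i ,_) (List.tabulate Fin.inject₁)) _ ⟩
      inversions (map (Fin.inject₁ i ,_) (List.tabulate Fin.inject₁)) + inversions [ Fin.inject₁ i , Fin.fromℕ A ]
        ≡⟨ cong₂ _+_ (inversions-none (All.map⁺ {f = Fin.inject₁ i ,_} (All.tabulate⁺ {f = Fin.inject₁} ¬inversion)))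
                     (inversions-[ _ ] inversion) ⟩
      1 ∎
      where
      open ≡-Reasoning
      ¬inversion : ∀ j → ¬ Inversion (Fin.inject₁ i , Fin.inject₁ j)
      ¬inversion j (i<j , wj<wi) =
        <-asym (subst₂ _<_ (toℕ-inject₁ i) (toℕ-inject₁ j) i<j)
               (≤-pred (subst₂ _<_ (cong toℕ (next-inject₁ j)) (cong toℕ (next-inject₁ i)) wj<wi))
      inversion : Inversion (Fin.inject₁ i , Fin.fromℕ A)
      inversion = subst₂ _<_ (sym (toℕ-inject₁ i)) (sym (toℕ-fromℕ A)) (toℕ<n i) ,
                  subst₂ Fin._<_ (sym next-fromℕ) (sym (next-inject₁ i)) (s≤s z≤n)

    row-fromℕ : inversions (map (Fin.fromℕ A ,_) positions) ≡ 0
    row-fromℕ = inversions-none (All.map⁺ {f = Fin.fromℕ A ,_} (All.tabulate⁺ {f = id} ¬ascending))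
      where
      ¬ascending : ∀ j → ¬ Inversion (Fin.fromℕ A , j)
      ¬ascending j (A<j , _) = <-irrefl refl (<-≤-trans (subst (_< toℕ j) (toℕ-fromℕ A) A<j) (≤-pred (toℕ<n j)))

    rows-inject₁ : ∀ {k} (g : Fin k → Fin A) →
                   inversions (List.cartesianProduct (List.tabulate (Fin.inject₁ ∘ g)) positions) ≡ k
    rows-inject₁ {zero}  g = refl
    rows-inject₁ {suc k} g =
      trans (inversions-++ (map (Fin.inject₁ (g Fin.zero) ,_) positions) _)
            (cong₂ _+_ (row-inject₁ (g Fin.zero)) (rows-inject₁ (g ∘ Fin.suc)))

  len-cycle : len cycle ≡ A
  len-cycle = begin
    inversions (List.cartesianProduct positions positions)
      ≡⟨ cong (λ xs → inversions (List.cartesianProduct xs positions)) positions-∷ʳ ⟩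
    inversions (List.cartesianProduct (List.tabulate Fin.inject₁ ∷ʳ Fin.fromℕ A) positions)
      ≡⟨ cong inversions (cartesianProduct-++ (List.tabulate Fin.inject₁) [ Fin.fromℕ A ] positions) ⟩
    inversions (List.cartesianProduct (List.tabulate Fin.inject₁) positions ++ (map (Fin.fromℕ A ,_) positions ++ []))
      ≡⟨ inversions-++ (List.cartesianProduct (List.tabulate Fin.inject₁) positions) _ ⟩
    inversions (List.cartesianProduct (List.tabulate Fin.inject₁) positions) + inversions (map (Fin.fromℕ A ,_) positions ++ [])
      ≡⟨ cong₂ _+_ (rows-inject₁ id) (cong inversions (List.++-identityʳ (map (Fin.fromℕ A ,_) positions))) ⟩
    A + inversions (map (Fin.fromℕ A ,_) positions)
      ≡⟨ cong (A +_) row-fromℕ ⟩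
    A + 0
      ≡⟨ +-identityʳ A ⟩
    A ∎
    where open ≡-Reasoning

corollary4p2 : (n : ℕ) → 2 < n →
    Σ ℕ (λ m → Σ (Permutation′ m) (λ w → Σ (List (Tile m)) (λ T →
    ElnitskyAdmissible w × len w ≡ (n * (n ∸ 1)) / 2 × IsTiling w T ×
    ((T′ : List (Tile n)) → IsTiling (reverse {n}) T′ → perim w T < perim (reverse {n}) T′))))
corollary4p2 n 2<n =
  suc A , cycle , strip , cycle-admissible 1≤A , len-cycle , strip-tiling ,
  λ T′ tiling → <-≤-trans (s≤s perim-strip≤2) (3≤perim T′ tiling)
  where
  A = (n * (n ∸ 1)) / 2
  open Cycle A
  open ReverseTilings n 2<n using (3≤perim)
  1≤A : 1 ≤ A
  1≤A = m≥n⇒m/n>0 (*-mono-≤ {1} {n} {2} {n ∸ 1} (<-trans (s≤s z≤n) 2<n) (∸-monoˡ-≤ 1 2<n))
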